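{- Let $\mathbb K$ be a field of characteristic $0$ and let $G=(V,E)$ be a simple undirected graph with $V=\{1,\dots,n\}$, $|E|\ge 2$ and minimum vertex degree $\delta(G)\ge 1$. If $G$ is disconnected, or if $G$ is articulated, then $r(G)=1$.
   Context: The graphic arrangement of $G$ is $\mathcal A(G)=\{V(x_i-x_j) : \{i,j\}\in E\}$ in $\mathbb K^n$. Let $W=\bigcap_{\{i,j\}\in E}\ker(x_i-x_j)$; the hyperplanes of $\mathcal A(G)$ induce an essential central arrangement $\bar{\mathcal A}$ in $\mathbb K^n/W$. With $F$ the defining polynomial of $\bar{\mathcal A}$ in linear coordinates $u_1,\dots,u_\ell$ of $\mathbb K^n/W$, $r(G)$ is the least $r$ such that there exist homogeneous polynomials $P_1,\dots,P_\ell$ of degree $r$, not all zero, with $\sum_k P_k\,\partial F/\partial u_k=0$. The graph $G$ is articulated if it is connected and has a vertex $v$ such that $G-\{v\}$ is disconnected (i.e. its vertex-connectivity is $1$). -}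

module Defs where

open import Level using (Level; _⊔_)
open import Data.Nat as ℕ using (ℕ; zero; suc; _<_)
open import Data.Fin as Fin using (Fin)
open import Data.Vec as Vec using (Vec; zipWith; replicate; updateAt; lookup)
open import Data.Vec.Properties using (≡-dec)
open import Data.List as List using (List; []; _∷_; _++_; length; concatMap; map; foldr; allFin)
open import Data.List.Membership.Propositional using (_∈_)
open import Data.List.Relation.Unary.Unique.Propositional using (Unique)
open import Data.Product using (Σ; ∃; ∃-syntax; _×_; _,_)
open import Data.Sum using (_⊎_)
open import Data.Unit.Polymorphic using (⊤)
open import Relation.Nullary using (¬_; yes; no)
open import Relation.Binary.PropositionalEquality using (_≡_; _≢_)
open import Algebra.Bundles using (CommutativeRing)

record Field (c ℓ : Level) : Set (Level.suc (c ⊔ ℓ)) where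
  field
    commutativeRing : CommutativeRing c ℓ
  open CommutativeRing commutativeRing public
  field
    1≉0     : ¬ (1# ≈ 0#)
    inverse : ∀ x → ¬ (x ≈ 0#) → ∃[ y ] (x * y ≈ 1#)

module _ {c ℓ} (K : Field c ℓ) where
  open Field K

  natCast : ℕ → Carrier
  natCast zero    = 0#
  natCast (suc n) = 1# + natCast n

  CharZero : Set ℓ
  CharZero = ∀ n → ¬ (natCast (suc n) ≈ 0#)

-- Simple undirected graphs on V = Fin n.
-- An edge {i,j} is stored once as the ordered pair (i , j) with i < j.

record Graph (n : ℕ) : Set where
  field
    edges   : List (Fin n × Fin n)
    ordered : ∀ {i j} → (i , j) ∈ edges → i Fin.< j
    unique  : Unique edges

module _ {n : ℕ} (G : Graph n) where
  open Graph G

  Adj : Fin n → Fin n → Set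
  Adj u v = (u , v) ∈ edges ⊎ (v , u) ∈ edges

  -- paths all of whose vertices satisfy P (P = induced subgraph)
  data PathIn (P : Fin n → Set) : Fin n → Fin n → Set where
    here : ∀ {u} → P u → PathIn P u u
    step : ∀ {u w v} → P u → Adj u w → PathIn P w v → PathIn P u v

  MinDegreeAtLeast1 : Set
  MinDegreeAtLeast1 = ∀ v → ∃[ w ] Adj v w

  Connected : Set
  Connected = ∀ u v → PathIn (λ _ → ⊤) u v

  Disconnected : Set
  Disconnected = ¬ Connected

  DisconnectedWithout : Fin n → Set
  DisconnectedWithout v =
    ∃[ u ] ∃[ w ] (u ≢ v × w ≢ v × ¬ PathIn (λ x → x ≢ v) u w)

  Articulated : Set
  Articulated = Connected × ∃[ v ] DisconnectedWithout v

module _ {c ℓ} (K : Field c ℓ) where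
  open Field K

  ΣK : ∀ {m} → (Fin m → Carrier) → Carrier
  ΣK {m} f = foldr (λ i s → f i + s) 0# (allFin m)

-- Polynomials in ℓ variables over K, as finite lists of terms
-- (coefficient , exponent vector); equality is equality of all coefficients.

module Poly {c ℓ} (K : Field c ℓ) (m : ℕ) where
  open Field K

  Monomial : Set
  Monomial = Vec ℕ m

  Pol : Set c
  Pol = List (Carrier × Monomial)

  coeff : Pol → Monomial → Carrier
  coeff []             μ = 0#
  coeff ((a , ν) ∷ p) μ with ≡-dec ℕ._≟_ ν μ
  ... | yes _ = a + coeff p μ
  ... | no  _ = coeff p μ

  _≈P_ : Pol → Pol → Set ℓ
  p ≈P q = ∀ μ → coeff p μ ≈ coeff q μ

  0P : Pol
  0P = []

  1P : Pol
  1P = (1# , replicate m 0) ∷ []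

  _+P_ : Pol → Pol → Pol
  _+P_ = _++_

  _*P_ : Pol → Pol → Pol
  p *P q = concatMap (λ { (a , μ) → map (λ { (b , ν) → (a * b , zipWith ℕ._+_ μ ν) }) q }) p

  prodP : List Pol → Pol
  prodP = foldr _*P_ 1P

  sumP : (Fin m → Pol) → Pol
  sumP f = foldr (λ k s → f k +P s) 0P (allFin m)

  ∂ : Fin m → Pol → Pol
  ∂ k = map (λ { (a , μ) → (natCast K (lookup μ k) * a , updateAt μ k ℕ.pred) })

  linear : (Fin m → Carrier) → Pol
  linear a = map (λ k → (a k , updateAt (replicate m 0) k suc)) (allFin m)

  degree : Monomial → ℕ
  degree = Vec.sum

  Homogeneous : ℕ → Pol → Set ℓ
  Homogeneous r p = ∀ μ → degree μ ≢ r → coeff p μ ≈ 0#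

-- Linear coordinates u_1..u_ℓ on K^n / W, W = ⋂_{ {i,j} ∈ E} ker(x_i - x_j).
-- They are given by a linear map π : K^n → K^ℓ (row k = the functional u_k)
-- that is surjective with kernel exactly W.  For each edge, form i j are the
-- coefficients of the hyperplane x_i - x_j written in the coordinates u.

module _ {c ℓ} (K : Field c ℓ) {n : ℕ} (G : Graph n) where
  open Field K
  open Graph G

  InW : (Fin n → Carrier) → Set ℓ
  InW x = ∀ {i j : Fin n} → (i , j) ∈ edges → x i ≈ x j

  record Coordinates : Set (c ⊔ ℓ) where
    field
      dim  : ℕ
      π    : Fin dim → Fin n → Carrier
      kerπ : ∀ x → ((∀ k → ΣK K (λ i → π k i * x i) ≈ 0#) → InW x)
                 × (InW x → ∀ k → ΣK K (λ i → π k i * x i) ≈ 0#)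
      surj : ∀ (y : Fin dim → Carrier) → Σ (Fin n → Carrier) λ x → (∀ k → ΣK K (λ i → π k i * x i) ≈ y k)
      form : Fin n → Fin n → Fin dim → Carrier
      form-spec : ∀ {i j : Fin n} → (i , j) ∈ edges → ∀ (x : Fin n → Carrier) →
                  ΣK K (λ (k : Fin dim) → form i j k * ΣK K (λ (i' : Fin n) → π k i' * x i')) ≈ x i - x j

  module _ (C : Coordinates) where
    open Coordinates C
    open Poly K dim

    -- defining polynomial F of the essential arrangement in coordinates u
    definingPoly : Pol
    definingPoly = prodP (map (λ { (i , j) → linear (form i j) }) edges)

    HasSyzygyOfDegree : ℕ → Set (c ⊔ ℓ)
    HasSyzygyOfDegree r =
      Σ (Fin dim → Pol) λ P → ((∀ k → Homogeneous r (P k))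
             × (Σ (Fin dim) λ k → ¬ (P k ≈P 0P))
             × (sumP (λ k → P k *P ∂ k definingPoly) ≈P 0P))

    rIs : ℕ → Set (c ⊔ ℓ)
    rIs r = HasSyzygyOfDegree r × (∀ s → s < r → ¬ HasSyzygyOfDegree s)

-- A cut of G is a vertex v together with a vertex set A such that every
-- edge leaving A ends at v and every vertex of A is joined to v; a
-- disconnected graph (A a component, v in it) and an articulated graph
-- (A a component of G - v) both have one.  Write N for the number of edges
-- and N₁ for the number of edges meeting A.  The linear map
--   θ(x)ᵢ = N·[i ∈ A]·(xᵢ - x_v) - N₁·xᵢ
-- preserves W and rescales every edge form: θ(xᵢ - xⱼ) = c_{ij}(xᵢ - xⱼ)
-- with c_{ij} = N·[{i,j} meets A] - N₁, so Σ c_{ij} = 0.  Its matrix M in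
-- the coordinates u gives the derivation D = Σₖ (Σⱼ M_{kj} uⱼ) ∂ₖ with
-- D(αₑ) = cₑ αₑ for every edge form αₑ; by the Leibniz rule D F = (Σ cₑ) F = 0,
-- a syzygy of degree 1.  It is nonzero because N₁ ≠ 0 and N - N₁ ≠ 0 in
-- characteristic 0 (minimum degree ≥ 1 puts an edge inside and outside A).
--
-- There is no syzygy of degree 0: constant coefficients aₖ give a derivation
-- D with D(αₑ) = bᵢ - bⱼ for a preimage b of a.  Evaluating D F at a point
-- where exactly the edge form of {i,j} vanishes shows bᵢ = bⱼ, so b ∈ W and
-- a = π b = 0.

module Submission where

open import Defs
open import Level using (Level)
open import Data.Nat using (ℕ; _≤_; _<_; z≤n; s≤s)
open import Data.List using (length)
open import Data.Sum using (_⊎_)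
open import Data.Product using (_,_)
open import Relation.Nullary using (¬_)

module FieldArithmetic {c ℓ} (K : Field c ℓ) where
  open import Data.Nat as ℕ using (zero; suc)
  open import Data.Integer as ℤ using (ℤ; +_; -[1+_]; _⊖_; sign; ∣_∣; _◃_)
  import Data.Integer.Properties as ℤP
  open import Data.Sign as Sign using (Sign)
  open import Data.Maybe using (Maybe; just; nothing)
  open import Data.Product using (_,_)
  open import Data.Empty using (⊥-elim)
  open import Relation.Nullary using (¬_; yes; no)
  open import Relation.Binary.PropositionalEquality as P using (_≡_)
  open import Algebra.Solver.Ring.AlmostCommutativeRing
  import Algebra.Solver.Ring as RingSolver
  import Algebra.Properties.Ring as RingProperties
  import Relation.Binary.Reasoning.Setoid as SetoidReasoning

  open Field K public hiding (zero)
  open RingProperties ring public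
    using (-‿involutive; -‿distribˡ-*; -‿distribʳ-*; -0#≈0#; -‿anti-homo-+)
  open SetoidReasoning setoid

  nc : ℕ → Carrier
  nc = natCast K

  nc-+ : ∀ m n → nc (m ℕ.+ n) ≈ nc m + nc n
  nc-+ zero n = sym (+-identityˡ _)
  nc-+ (suc m) n = trans (+-congˡ (nc-+ m n)) (sym (+-assoc _ _ _))

  nc-* : ∀ m n → nc (m ℕ.* n) ≈ nc m * nc n
  nc-* zero n = sym (zeroˡ _)
  nc-* (suc m) n = begin
    nc (n ℕ.+ m ℕ.* n)      ≈⟨ nc-+ n (m ℕ.* n) ⟩
    nc n + nc (m ℕ.* n)     ≈⟨ +-cong (sym (*-identityˡ _)) (nc-* m n) ⟩
    1# * nc n + nc m * nc n ≈⟨ sym (distribʳ _ _ _) ⟩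
    (1# + nc m) * nc n      ∎

  -- The ring solver for K needs the homomorphism ℤ → K; it is built from
  -- the cast of the absolute value and the sign.
  private
    applySign : Sign → Carrier → Carrier
    applySign Sign.+ x = x
    applySign Sign.- x = - x

    applySign-cong : ∀ s {x y} → x ≈ y → applySign s x ≈ applySign s y
    applySign-cong Sign.+ e = e
    applySign-cong Sign.- e = -‿cong e

    applySign-* : ∀ s t x y → applySign (s Sign.* t) (x * y) ≈ applySign s x * applySign t y
    applySign-* Sign.- Sign.- x y =
      sym (trans (sym (-‿distribˡ-* _ _)) (trans (-‿cong (sym (-‿distribʳ-* _ _))) (-‿involutive _)))
    applySign-* Sign.- Sign.+ x y = -‿distribˡ-* _ _
    applySign-* Sign.+ Sign.- x y = -‿distribʳ-* _ _
    applySign-* Sign.+ Sign.+ x y = refl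

  ⟦_⟧ℤ : ℤ → Carrier
  ⟦ i ⟧ℤ = applySign (sign i) (nc ∣ i ∣)

  private
    ◃-hom : ∀ s n → ⟦ s ◃ n ⟧ℤ ≈ applySign s (nc n)
    ◃-hom Sign.+ zero = refl
    ◃-hom Sign.- zero = sym -0#≈0#
    ◃-hom Sign.+ (suc n) = refl
    ◃-hom Sign.- (suc n) = refl

    neg-hom : ∀ i → ⟦ ℤ.- i ⟧ℤ ≈ - ⟦ i ⟧ℤ
    neg-hom -[1+ n ] = sym (-‿involutive _)
    neg-hom (+ zero) = sym -0#≈0#
    neg-hom (+ suc n) = refl

    cancel-1# : ∀ a b → (1# + a) - (1# + b) ≈ a - b
    cancel-1# a b = begin
      (1# + a) + - (1# + b)   ≈⟨ +-congˡ (-‿anti-homo-+ _ _) ⟩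
      (1# + a) + (- b + - 1#) ≈⟨ +-congʳ (+-comm _ _) ⟩
      (a + 1#) + (- b + - 1#) ≈⟨ +-assoc _ _ _ ⟩
      a + (1# + (- b + - 1#)) ≈⟨ +-congˡ (+-congˡ (+-comm _ _)) ⟩
      a + (1# + (- 1# + - b)) ≈⟨ +-congˡ (sym (+-assoc _ _ _)) ⟩
      a + ((1# + - 1#) + - b) ≈⟨ +-congˡ (+-congʳ (-‿inverseʳ _)) ⟩
      a + (0# + - b)          ≈⟨ +-congˡ (+-identityˡ _) ⟩
      a - b                   ∎

    ⊖-hom : ∀ m n → ⟦ m ⊖ n ⟧ℤ ≈ nc m - nc n
    ⊖-hom m zero = begin
      ⟦ m ⊖ zero ⟧ℤ ≡⟨ P.cong ⟦_⟧ℤ (ℤP.⊖-≥ {m} {zero} ℕ.z≤n) ⟩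
      nc m          ≈⟨ sym (+-identityʳ _) ⟩
      nc m + 0#     ≈⟨ +-congˡ (sym -0#≈0#) ⟩
      nc m - 0#     ∎
    ⊖-hom zero (suc n) = begin
      ⟦ zero ⊖ suc n ⟧ℤ ≡⟨ P.cong ⟦_⟧ℤ (ℤP.⊖-< {zero} {suc n} (ℕ.s≤s ℕ.z≤n)) ⟩
      - nc (suc n)      ≈⟨ sym (+-identityˡ _) ⟩
      0# - nc (suc n)   ∎
    ⊖-hom (suc m) (suc n) = begin
      ⟦ suc m ⊖ suc n ⟧ℤ        ≡⟨ P.cong ⟦_⟧ℤ (ℤP.[1+m]⊖[1+n]≡m⊖n m n) ⟩
      ⟦ m ⊖ n ⟧ℤ                ≈⟨ ⊖-hom m n ⟩
      nc m - nc n               ≈⟨ sym (cancel-1# _ _) ⟩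
      nc (suc m) - nc (suc n)   ∎

    +-hom : ∀ i j → ⟦ i ℤ.+ j ⟧ℤ ≈ ⟦ i ⟧ℤ + ⟦ j ⟧ℤ
    +-hom -[1+ m ] -[1+ n ] = begin
      - nc (suc (suc (m ℕ.+ n)))   ≈⟨ -‿cong (+-congˡ (nc-+ (suc m) n)) ⟩
      - (1# + (nc (suc m) + nc n)) ≈⟨ -‿cong (trans (+-congˡ (+-comm _ _)) (sym (+-assoc _ _ _))) ⟩
      - ((1# + nc n) + nc (suc m)) ≈⟨ -‿anti-homo-+ _ _ ⟩
      - nc (suc m) + - nc (suc n)  ∎
    +-hom -[1+ m ] (+ n) = trans (⊖-hom n (suc m)) (+-comm _ _)
    +-hom (+ m) -[1+ n ] = ⊖-hom m (suc n)
    +-hom (+ m) (+ n) = nc-+ m n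

    *-hom : ∀ i j → ⟦ i ℤ.* j ⟧ℤ ≈ ⟦ i ⟧ℤ * ⟦ j ⟧ℤ
    *-hom i j = begin
      ⟦ (sign i Sign.* sign j) ◃ (∣ i ∣ ℕ.* ∣ j ∣) ⟧ℤ
        ≈⟨ ◃-hom (sign i Sign.* sign j) (∣ i ∣ ℕ.* ∣ j ∣) ⟩
      applySign (sign i Sign.* sign j) (nc (∣ i ∣ ℕ.* ∣ j ∣))
        ≈⟨ applySign-cong (sign i Sign.* sign j) (nc-* ∣ i ∣ ∣ j ∣) ⟩
      applySign (sign i Sign.* sign j) (nc ∣ i ∣ * nc ∣ j ∣)
        ≈⟨ applySign-* (sign i) (sign j) (nc ∣ i ∣) (nc ∣ j ∣) ⟩
      ⟦ i ⟧ℤ * ⟦ j ⟧ℤ ∎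

    ℤ-morphism : ℤ.+-*-rawRing -Raw-AlmostCommutative⟶ fromCommutativeRing commutativeRing
    ℤ-morphism = record
      { ⟦_⟧ = ⟦_⟧ℤ ; +-homo = +-hom ; *-homo = *-hom ; -‿homo = neg-hom
      ; 0-homo = refl ; 1-homo = +-identityʳ _ }

    ℤ-coefficient? : ∀ i j → Maybe (⟦ i ⟧ℤ ≈ ⟦ j ⟧ℤ)
    ℤ-coefficient? i j with i ℤ.≟ j
    ... | yes P.refl = just refl
    ... | no _ = nothing

  open RingSolver ℤ.+-*-rawRing (fromCommutativeRing commutativeRing) ℤ-morphism ℤ-coefficient? public
    using (solve; _:=_; _:+_; _:*_; :-_; _:-_; con)

  diff0 : ∀ {a b} → a - b ≈ 0# → a ≈ b
  diff0 {a} {b} e = trans (solve 2 (λ a b → a := (a :- b) :+ b) refl a b) (trans (+-congʳ e) (+-identityˡ _))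

  +-cancelˡ : ∀ {x y z} → x + y ≈ x + z → y ≈ z
  +-cancelˡ {x} {y} {z} e = begin
    y             ≈⟨ solve 2 (λ x y → y := (:- x) :+ (x :+ y)) refl x y ⟩
    (- x) + (x + y) ≈⟨ +-congˡ e ⟩
    (- x) + (x + z) ≈⟨ solve 2 (λ x z → (:- x) :+ (x :+ z) := z) refl x z ⟩
    z             ∎

  cancelNZ : ∀ {x a} → ¬ (x ≈ 0#) → x * a ≈ 0# → a ≈ 0#
  cancelNZ {x} {a} nz e with inverse x nz
  ... | (y , xy) = begin
    a           ≈⟨ sym (*-identityˡ a) ⟩
    1# * a      ≈⟨ *-congʳ (sym xy) ⟩
    (x * y) * a ≈⟨ solve 3 (λ x y a → (x :* y) :* a := y :* (x :* a)) refl x y a ⟩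
    y * (x * a) ≈⟨ *-congˡ e ⟩
    y * 0#      ≈⟨ zeroʳ _ ⟩
    0#          ∎

  nz-mul : ∀ {x y} → ¬ (x ≈ 0#) → ¬ (y ≈ 0#) → ¬ (x * y ≈ 0#)
  nz-mul nx ny e = ny (cancelNZ nx e)

  nc-injective : CharZero K → ∀ a b → nc a ≈ nc b → a ≡ b
  nc-injective cz zero zero e = P.refl
  nc-injective cz zero (suc b) e = ⊥-elim (cz b (sym e))
  nc-injective cz (suc a) zero e = ⊥-elim (cz a e)
  nc-injective cz (suc a) (suc b) e = P.cong suc (nc-injective cz a b (+-cancelˡ e))

module Counting where
  open import Data.Nat as ℕ using (suc; _<_; z≤n; s≤s)
  import Data.Nat.Properties as ℕP
  open import Data.Bool using (Bool; true; false; if_then_else_; not)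
  open import Data.List as List using (List; []; _∷_)
  open import Data.List.Membership.Propositional using (_∈_)
  open import Data.List.Relation.Unary.Any using (here; there)
  open import Data.Product using (∃-syntax; _,_)
  open import Data.Empty using (⊥-elim)
  open import Relation.Binary.PropositionalEquality as P using (_≡_; _≢_)

  count : ∀ {X : Set} → (X → Bool) → List X → ℕ
  count f [] = 0
  count f (x ∷ xs) = if f x then suc (count f xs) else count f xs

  count-≤-length : ∀ {X : Set} (f : X → Bool) xs → count f xs ≤ List.length xs
  count-≤-length f [] = z≤n
  count-≤-length f (x ∷ xs) with f x
  ... | true = s≤s (count-≤-length f xs)
  ... | false = ℕP.m≤n⇒m≤1+n (count-≤-length f xs)

  count-split : ∀ {X : Set} (f : X → Bool) xs → List.length xs ≡ count f xs ℕ.+ count (λ x → not (f x)) xs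
  count-split f [] = P.refl
  count-split f (x ∷ xs) with f x
  ... | true = P.cong suc (count-split f xs)
  ... | false = P.trans (P.cong suc (count-split f xs)) (P.sym (ℕP.+-suc _ _))

  count-pos : ∀ {X : Set} (f : X → Bool) xs e → e ∈ xs → f e ≡ true → ∃[ k ] (count f xs ≡ suc k)
  count-pos f (x ∷ xs) e (here P.refl) fe rewrite fe = count f xs , P.refl
  count-pos f (x ∷ xs) e (there mem) fe with f x
  ... | true = count f xs , P.refl
  ... | false = count-pos f xs e mem fe

  private
    true≢false : true ≢ false
    true≢false ()

  count-mono : ∀ {X : Set} (f g : X → Bool) xs → (∀ x → f x ≡ true → g x ≡ true) → count f xs ≤ count g xs
  count-mono f g [] h = z≤n
  count-mono f g (x ∷ xs) h with f x in ef | g x in eg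
  ... | true | true = s≤s (count-mono f g xs h)
  ... | true | false = ⊥-elim (true≢false (P.trans (P.sym (h x ef)) eg))
  ... | false | true = ℕP.m≤n⇒m≤1+n (count-mono f g xs h)
  ... | false | false = count-mono f g xs h

  count-strict : ∀ {X : Set} (f g : X → Bool) xs → (∀ x → f x ≡ true → g x ≡ true) →
                 ∀ y → y ∈ xs → g y ≡ true → f y ≡ false → count f xs < count g xs
  count-strict f g (x ∷ xs) h y (here P.refl) gy fy rewrite gy | fy = s≤s (count-mono f g xs h)
  count-strict f g (x ∷ xs) h y (there m) gy fy with f x in ef | g x in eg
  ... | true | true = s≤s (count-strict f g xs h y m gy fy)
  ... | true | false = ⊥-elim (true≢false (P.trans (P.sym (h x ef)) eg))
  ... | false | true = ℕP.m≤n⇒m≤1+n (count-strict f g xs h y m gy fy)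
  ... | false | false = count-strict f g xs h y m gy fy

module FiniteSums {c ℓ} (K : Field c ℓ) where
  open import Data.Fin as Fin using (Fin)
  open import Data.Bool using (Bool; true; false; if_then_else_)
  open import Data.List as List using (List; []; _∷_; foldr; allFin)
  open import Data.List.Membership.Propositional using (_∈_)
  open import Data.List.Membership.Propositional.Properties using (∈-allFin)
  open import Data.List.Relation.Unary.Any using (here; there)
  open import Data.List.Relation.Unary.All using (All; []; _∷_)
  open import Data.List.Relation.Unary.Unique.Propositional using (Unique)
  open import Data.List.Relation.Unary.Unique.Propositional.Properties using (allFin⁺)
  open import Data.List.Relation.Unary.AllPairs using ([]; _∷_)
  open import Relation.Nullary using (¬_; yes; no)
  open import Relation.Binary.Definitions using (DecidableEquality)
  open import Data.Empty using (⊥-elim)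
  open import Relation.Binary.PropositionalEquality as P using (_≡_; _≢_)
  import Relation.Binary.Reasoning.Setoid as SetoidReasoning

  open FieldArithmetic K
  open Counting
  open SetoidReasoning setoid

  ΣL : ∀ {I : Set} → (I → Carrier) → List I → Carrier
  ΣL f xs = foldr (λ i s → f i + s) 0# xs

  module _ {I : Set} where
    ΣL-cong : ∀ {f g : I → Carrier} xs → (∀ i → f i ≈ g i) → ΣL f xs ≈ ΣL g xs
    ΣL-cong [] e = refl
    ΣL-cong (x ∷ xs) e = +-cong (e x) (ΣL-cong xs e)

    ΣL-+ : ∀ (f g : I → Carrier) xs → ΣL (λ i → f i + g i) xs ≈ ΣL f xs + ΣL g xs
    ΣL-+ f g [] = sym (+-identityʳ _)
    ΣL-+ f g (x ∷ xs) = trans (+-congˡ (ΣL-+ f g xs))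
      (solve 4 (λ a b c d → (a :+ b) :+ (c :+ d) := (a :+ c) :+ (b :+ d)) refl (f x) (g x) (ΣL f xs) (ΣL g xs))

    ΣL-*ˡ : ∀ a (f : I → Carrier) xs → ΣL (λ i → a * f i) xs ≈ a * ΣL f xs
    ΣL-*ˡ a f [] = sym (zeroʳ _)
    ΣL-*ˡ a f (x ∷ xs) = trans (+-congˡ (ΣL-*ˡ a f xs)) (sym (distribˡ _ _ _))

    ΣL-neg : ∀ (f : I → Carrier) xs → ΣL (λ i → - f i) xs ≈ - ΣL f xs
    ΣL-neg f [] = sym -0#≈0#
    ΣL-neg f (x ∷ xs) = trans (+-congˡ (ΣL-neg f xs)) (solve 2 (λ a b → (:- a) :+ (:- b) := :- (a :+ b)) refl (f x) (ΣL f xs))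

    ΣL-- : ∀ (f g : I → Carrier) xs → ΣL (λ i → f i - g i) xs ≈ ΣL f xs - ΣL g xs
    ΣL-- f g xs = trans (ΣL-+ f (λ i → - g i) xs) (+-congˡ (ΣL-neg g xs))

    ΣL-0 : ∀ {f : I → Carrier} xs → (∀ i → f i ≈ 0#) → ΣL f xs ≈ 0#
    ΣL-0 [] e = refl
    ΣL-0 (x ∷ xs) e = trans (+-cong (e x) (ΣL-0 xs e)) (+-identityˡ _)

    ΣL-0∈ : ∀ {f : I → Carrier} xs → (∀ i → i ∈ xs → f i ≈ 0#) → ΣL f xs ≈ 0#
    ΣL-0∈ [] e = refl
    ΣL-0∈ (x ∷ xs) e = trans (+-cong (e x (here P.refl)) (ΣL-0∈ xs (λ i m → e i (there m)))) (+-identityˡ _)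

    ∉-tail : ∀ {x : I} {xs i} → All (λ y → ¬ x ≡ y) xs → i ∈ xs → i ≢ x
    ∉-tail (a ∷ as) (here P.refl) P.refl = a P.refl
    ∉-tail (a ∷ as) (there m) e = ∉-tail as m e

    ΣL-delta : (_≟_ : DecidableEquality I) → ∀ {f : I → Carrier} xs k → Unique xs → k ∈ xs →
               (∀ i → i ≢ k → f i ≈ 0#) → ΣL f xs ≈ f k
    ΣL-delta _≟_ (x ∷ xs) k (ux ∷ u) (here P.refl) h =
      trans (+-congˡ (ΣL-0∈ xs (λ i m → h i (∉-tail ux m)))) (+-identityʳ _)
    ΣL-delta _≟_ (x ∷ xs) k (ux ∷ u) (there m) h with x ≟ k
    ... | yes P.refl = trans (+-congˡ (ΣL-0∈ xs (λ i m' → h i (∉-tail ux m')))) (+-identityʳ _)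
    ... | no ne = trans (+-cong (h x ne) (ΣL-delta _≟_ xs k u m h)) (+-identityˡ _)

  ΣL-swap : ∀ {I J : Set} (f : I → J → Carrier) xs ys →
            ΣL (λ i → ΣL (λ j → f i j) ys) xs ≈ ΣL (λ j → ΣL (λ i → f i j) xs) ys
  ΣL-swap f [] ys = sym (ΣL-0 ys (λ _ → refl))
  ΣL-swap f (x ∷ xs) ys = trans (+-congˡ (ΣL-swap f xs ys)) (sym (ΣL-+ (f x) (λ j → ΣL (λ i → f i j) xs) ys))

  indicator : Bool → Carrier
  indicator b = if b then 1# else 0#

  ΣL-indicator : ∀ {X : Set} (f : X → Bool) xs → ΣL (λ x → indicator (f x)) xs ≈ nc (count f xs)
  ΣL-indicator f [] = refl
  ΣL-indicator f (x ∷ xs) with f x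
  ... | true = +-congˡ (ΣL-indicator f xs)
  ... | false = trans (+-identityˡ _) (ΣL-indicator f xs)

  ΣL-1 : ∀ {X : Set} (xs : List X) → ΣL (λ _ → 1#) xs ≈ nc (List.length xs)
  ΣL-1 [] = refl
  ΣL-1 (x ∷ xs) = +-congˡ (ΣL-1 xs)

  δ : ∀ {m} → Fin m → Fin m → Carrier
  δ j k with j Fin.≟ k
  ... | yes _ = 1#
  ... | no _ = 0#

  δ-same : ∀ {m} (j : Fin m) → δ j j ≈ 1#
  δ-same j with j Fin.≟ j
  ... | yes _ = refl
  ... | no ne = ⊥-elim (ne P.refl)

  δ-diff : ∀ {m} (j i : Fin m) → j ≢ i → δ j i ≈ 0#
  δ-diff j i ne with j Fin.≟ i
  ... | yes e = ⊥-elim (ne e)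
  ... | no _ = refl

  Σ-δʳ : ∀ {m} (b : Fin m → Carrier) j → ΣL (λ k → b k * δ j k) (allFin m) ≈ b j
  Σ-δʳ {m} b j = trans
    (ΣL-delta Fin._≟_ (allFin m) j (allFin⁺ m) (∈-allFin j) (λ i ne → trans (*-congˡ (δ-diff j i (λ e → ne (P.sym e)))) (zeroʳ _)))
    (trans (*-congˡ (δ-same j)) (*-identityʳ _))

  Σ-δˡ : ∀ {m} (b : Fin m → Carrier) k → ΣL (λ j → b j * δ j k) (allFin m) ≈ b k
  Σ-δˡ {m} b k = trans
    (ΣL-delta Fin._≟_ (allFin m) k (allFin⁺ m) (∈-allFin k) (λ i ne → trans (*-congˡ (δ-diff i k ne)) (zeroʳ _)))
    (trans (*-congˡ (δ-same k)) (*-identityʳ _))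

module ExponentVectors where
  open import Data.Nat as ℕ using (zero; suc)
  import Data.Nat.Properties as ℕP
  open import Data.Fin as Fin using (Fin)
  open import Data.Vec as Vec using (Vec; []; _∷_; zipWith; replicate; updateAt; lookup)
  import Data.Vec.Properties as VecP
  open import Relation.Nullary using (yes; no)
  open import Data.Empty using (⊥-elim)
  open import Relation.Binary.PropositionalEquality as P using (_≡_; _≢_)

  infixl 6 _⊕_
  _⊕_ : ∀ {n} → Vec ℕ n → Vec ℕ n → Vec ℕ n
  _⊕_ = zipWith ℕ._+_

  ⊕-cancelˡ : ∀ {n} (α β ν : Vec ℕ n) → α ⊕ β ≡ α ⊕ ν → β ≡ ν
  ⊕-cancelˡ [] [] [] e = P.refl
  ⊕-cancelˡ (a ∷ α) (b ∷ β) (x ∷ ν) e =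
    P.cong₂ _∷_ (ℕP.+-cancelˡ-≡ a b x (P.cong Vec.head e)) (⊕-cancelˡ α β ν (P.cong Vec.tail e))

  ⊕-comm : ∀ {n} (α β : Vec ℕ n) → α ⊕ β ≡ β ⊕ α
  ⊕-comm [] [] = P.refl
  ⊕-comm (a ∷ α) (b ∷ β) = P.cong₂ _∷_ (ℕP.+-comm a b) (⊕-comm α β)

  ⊕-assoc : ∀ {n} (α β γ : Vec ℕ n) → (α ⊕ β) ⊕ γ ≡ α ⊕ (β ⊕ γ)
  ⊕-assoc [] [] [] = P.refl
  ⊕-assoc (a ∷ α) (b ∷ β) (x ∷ γ) = P.cong₂ _∷_ (ℕP.+-assoc a b x) (⊕-assoc α β γ)

  ⊕-identityˡ : ∀ {n} (β : Vec ℕ n) → replicate n 0 ⊕ β ≡ β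
  ⊕-identityˡ [] = P.refl
  ⊕-identityˡ (b ∷ β) = P.cong (b ∷_) (⊕-identityˡ β)

  -- Whether μ is a multiple of α is decided by comparing α ⊕ (μ ∸ α) with μ.
  _∸v_ : ∀ {n} → Vec ℕ n → Vec ℕ n → Vec ℕ n
  _∸v_ = zipWith ℕ._∸_

  ⊕-∸v : ∀ {n} (α β μ : Vec ℕ n) → α ⊕ β ≡ μ → β ≡ μ ∸v α
  ⊕-∸v [] [] [] e = P.refl
  ⊕-∸v (a ∷ α) (b ∷ β) (x ∷ μ) e = P.cong₂ _∷_
    (P.trans (P.sym (ℕP.m+n∸m≡n a b)) (P.cong (ℕ._∸ a) (P.cong Vec.head e))) (⊕-∸v α β μ (P.cong Vec.tail e))

  lookup-⊕ : ∀ {n} (α β : Vec ℕ n) k → lookup (α ⊕ β) k ≡ lookup α k ℕ.+ lookup β k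
  lookup-⊕ (a ∷ α) (b ∷ β) Fin.zero = P.refl
  lookup-⊕ (a ∷ α) (b ∷ β) (Fin.suc k) = lookup-⊕ α β k

  lower : ∀ {n} → Vec ℕ n → Fin n → Vec ℕ n
  lower μ k = updateAt μ k ℕ.pred

  lower-⊕ˡ : ∀ {n} (α β : Vec ℕ n) k {x} → lookup α k ≡ suc x → lower (α ⊕ β) k ≡ lower α k ⊕ β
  lower-⊕ˡ (suc a ∷ α) (b ∷ β) Fin.zero P.refl = P.refl
  lower-⊕ˡ (a ∷ α) (b ∷ β) (Fin.suc k) e = P.cong (a ℕ.+ b ∷_) (lower-⊕ˡ α β k e)

  lower-⊕ʳ : ∀ {n} (α β : Vec ℕ n) k {y} → lookup β k ≡ suc y → lower (α ⊕ β) k ≡ α ⊕ lower β k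
  lower-⊕ʳ (a ∷ α) (suc b ∷ β) Fin.zero P.refl = P.cong (_∷ (α ⊕ β)) (P.cong ℕ.pred (ℕP.+-suc a b))
  lower-⊕ʳ (a ∷ α) (b ∷ β) (Fin.suc k) e = P.cong (a ℕ.+ b ∷_) (lower-⊕ʳ α β k e)

  lower-⊕ʳ-zero : ∀ {n} (α β : Vec ℕ n) k → lookup α k ≡ 0 → lower (α ⊕ β) k ≡ α ⊕ lower β k
  lower-⊕ʳ-zero (zero ∷ α) (b ∷ β) Fin.zero P.refl = P.refl
  lower-⊕ʳ-zero (a ∷ α) (b ∷ β) (Fin.suc k) e = P.cong (a ℕ.+ b ∷_) (lower-⊕ʳ-zero α β k e)

  unit : ∀ {n} → Fin n → Vec ℕ n
  unit j = updateAt (replicate _ 0) j suc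

  lookup-unit-same : ∀ {n} (j : Fin n) → lookup (unit j) j ≡ 1
  lookup-unit-same Fin.zero = P.refl
  lookup-unit-same (Fin.suc j) = lookup-unit-same j

  lookup-unit-diff : ∀ {n} (j k : Fin n) → j ≢ k → lookup (unit j) k ≡ 0
  lookup-unit-diff Fin.zero Fin.zero ne = ⊥-elim (ne P.refl)
  lookup-unit-diff Fin.zero (Fin.suc k) ne = VecP.lookup-replicate k 0
  lookup-unit-diff (Fin.suc j) Fin.zero ne = P.refl
  lookup-unit-diff (Fin.suc j) (Fin.suc k) ne = lookup-unit-diff j k (λ e → ne (P.cong Fin.suc e))

  lower-unit : ∀ {n} (k : Fin n) → lower (unit k) k ≡ replicate n 0
  lower-unit Fin.zero = P.refl
  lower-unit (Fin.suc k) = P.cong (0 ∷_) (lower-unit k)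

  unit-injective : ∀ {n} (j k : Fin n) → unit j ≡ unit k → j ≡ k
  unit-injective j k e with j Fin.≟ k
  ... | yes j≡k = j≡k
  ... | no j≢k = ⊥-elim (ℕP.1+n≢0 (P.trans (P.sym (lookup-unit-same j))
          (P.trans (P.cong (λ v → lookup v j) e) (lookup-unit-diff k j (λ x → j≢k (P.sym x))))))

  sum-zeros : ∀ n → Vec.sum (replicate n 0) ≡ 0
  sum-zeros zero = P.refl
  sum-zeros (suc n) = sum-zeros n

  sum-unit : ∀ {n} (k : Fin n) → Vec.sum (unit k) ≡ 1
  sum-unit {suc n} Fin.zero = P.cong suc (sum-zeros n)
  sum-unit (Fin.suc k) = sum-unit k

  sum≡0⇒zeros : ∀ {n} (μ : Vec ℕ n) → Vec.sum μ ≡ 0 → μ ≡ replicate n 0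
  sum≡0⇒zeros [] e = P.refl
  sum≡0⇒zeros (zero ∷ μ) e = P.cong (0 ∷_) (sum≡0⇒zeros μ e)
  sum≡0⇒zeros (suc x ∷ μ) ()

module PolynomialRing {c ℓ} (K : Field c ℓ) (m : ℕ) where
  open import Data.Nat as ℕ using (zero; suc)
  import Data.Nat.Properties as ℕP
  open import Data.Fin as Fin using (Fin)
  open import Data.Vec as Vec using (lookup)
  open import Data.Vec.Properties using (≡-dec)
  open import Data.List as List using ([]; _∷_; _++_; map)
  import Data.List.Properties as ListP
  open import Data.Product using (_×_; _,_)
  open import Relation.Nullary using (yes; no; Dec)
  open import Data.Empty using (⊥-elim)
  open import Relation.Binary.PropositionalEquality as P using (_≡_; _≢_)
  import Relation.Binary.Reasoning.Setoid as SetoidReasoning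
  open import Relation.Binary.Bundles using (Setoid)
  open ExponentVectors

  open FieldArithmetic K
  open Poly K m
  open SetoidReasoning setoid

  Term : Set c
  Term = Carrier × Monomial

  mulT : Term → Pol → Pol
  mulT (a , α) q = map (λ { (b , β) → (a * b , α ⊕ β) }) q

  -- Equality of polynomials: all coefficients agree.  It is wrapped in a
  -- record so that both polynomials can be inferred from a proof.
  infix 4 _≋_
  record _≋_ (p q : Pol) : Set ℓ where
    constructor mk
    field get : p ≈P q
  open _≋_ public

  ≋-refl : ∀ {p} → p ≋ p
  ≋-refl = mk λ μ → refl
  ≋-sym : ∀ {p q} → p ≋ q → q ≋ p
  ≋-sym (mk e) = mk λ μ → sym (e μ)
  ≋-trans : ∀ {p q r} → p ≋ q → q ≋ r → p ≋ r
  ≋-trans (mk e) (mk f) = mk λ μ → trans (e μ) (f μ)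

  ≡⇒≋ : ∀ {p q} → p ≡ q → p ≋ q
  ≡⇒≋ P.refl = ≋-refl

  polSetoid : Setoid c ℓ
  polSetoid = record { Carrier = Pol ; _≈_ = _≋_ ; isEquivalence = record { refl = ≋-refl ; sym = ≋-sym ; trans = ≋-trans } }

  module PR = SetoidReasoning polSetoid

  coeff-++ : ∀ p q μ → coeff (p ++ q) μ ≈ coeff p μ + coeff q μ
  coeff-++ [] q μ = sym (+-identityˡ _)
  coeff-++ ((a , ν) ∷ p) q μ with ≡-dec ℕ._≟_ ν μ
  ... | yes _ = trans (+-congˡ (coeff-++ p q μ)) (sym (+-assoc _ _ _))
  ... | no _ = coeff-++ p q μ

  coeff-cons : ∀ a ν p μ → coeff ((a , ν) ∷ p) μ ≈ coeff ((a , ν) ∷ []) μ + coeff p μ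
  coeff-cons a ν p μ = coeff-++ ((a , ν) ∷ []) p μ

  coeff-single-yes : ∀ a μ → coeff ((a , μ) ∷ []) μ ≈ a
  coeff-single-yes a μ with ≡-dec ℕ._≟_ μ μ
  ... | yes _ = +-identityʳ _
  ... | no ne = ⊥-elim (ne P.refl)

  coeff-single-no : ∀ a ν μ → ν ≢ μ → coeff ((a , ν) ∷ []) μ ≈ 0#
  coeff-single-no a ν μ ne with ≡-dec ℕ._≟_ ν μ
  ... | yes e = ⊥-elim (ne e)
  ... | no _ = refl

  ++-cong : ∀ {p p' q q'} → p ≋ p' → q ≋ q' → (p ++ q) ≋ (p' ++ q')
  ++-cong {p} {p'} {q} {q'} (mk e) (mk f) = mk λ μ → trans (coeff-++ p q μ) (trans (+-cong (e μ) (f μ)) (sym (coeff-++ p' q' μ)))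

  ++-idʳ : ∀ p q → q ≋ [] → (p ++ q) ≋ p
  ++-idʳ p q (mk e) = mk λ μ → trans (coeff-++ p q μ) (trans (+-congˡ (e μ)) (+-identityʳ _))

  ++-interchange : ∀ A B C D → ((A ++ B) ++ (C ++ D)) ≋ ((A ++ C) ++ (B ++ D))
  ++-interchange A B C D = mk λ μ → begin
    coeff ((A ++ B) ++ (C ++ D)) μ ≈⟨ coeff-++ (A ++ B) (C ++ D) μ ⟩
    coeff (A ++ B) μ + coeff (C ++ D) μ ≈⟨ +-cong (coeff-++ A B μ) (coeff-++ C D μ) ⟩
    (coeff A μ + coeff B μ) + (coeff C μ + coeff D μ) ≈⟨ solve 4 (λ a b c d → (a :+ b) :+ (c :+ d) := (a :+ c) :+ (b :+ d)) refl (coeff A μ) (coeff B μ) (coeff C μ) (coeff D μ) ⟩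
    (coeff A μ + coeff C μ) + (coeff B μ + coeff D μ) ≈⟨ sym (+-cong (coeff-++ A C μ) (coeff-++ B D μ)) ⟩
    coeff (A ++ C) μ + coeff (B ++ D) μ ≈⟨ sym (coeff-++ (A ++ C) (B ++ D) μ) ⟩
    coeff ((A ++ C) ++ (B ++ D)) μ ∎

  data PW : Pol → Pol → Set (c Level.⊔ ℓ) where
    pw[] : PW [] []
    pw∷ : ∀ {a b μ ν p q} → a ≈ b → μ ≡ ν → PW p q → PW ((a , μ) ∷ p) ((b , ν) ∷ q)

  PW⇒≋ : ∀ {p q} → PW p q → p ≋ q
  PW⇒≋ pw[] = mk λ μ → refl
  PW⇒≋ (pw∷ {a} {b} {ν} {_} {p} {q} e P.refl r) = mk λ μ → begin
    coeff ((a , ν) ∷ p) μ ≈⟨ coeff-cons a ν p μ ⟩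
    coeff ((a , ν) ∷ []) μ + coeff p μ ≈⟨ +-cong (lem μ) (get (PW⇒≋ r) μ) ⟩
    coeff ((b , ν) ∷ []) μ + coeff q μ ≈⟨ sym (coeff-cons b ν q μ) ⟩
    coeff ((b , ν) ∷ q) μ ∎
    where
    lem : ∀ μ → coeff ((a , ν) ∷ []) μ ≈ coeff ((b , ν) ∷ []) μ
    lem μ with ≡-dec ℕ._≟_ ν μ
    ... | yes _ = +-congʳ e
    ... | no _ = refl

  *P-++ˡ : ∀ p p' q → ((p ++ p') *P q) ≡ ((p *P q) ++ (p' *P q))
  *P-++ˡ [] p' q = P.refl
  *P-++ˡ (t ∷ p) p' q = P.trans (P.cong (mulT t q ++_) (*P-++ˡ p p' q)) (P.sym (ListP.++-assoc (mulT t q) (p *P q) (p' *P q)))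

  mulT-++ : ∀ t q q' → mulT t (q ++ q') ≡ (mulT t q ++ mulT t q')
  mulT-++ (a , α) q q' = ListP.map-++ _ q q'

  *P-[]ʳ : ∀ p → (p *P []) ≡ []
  *P-[]ʳ [] = P.refl
  *P-[]ʳ (t ∷ p) = *P-[]ʳ p

  *P-++ʳ : ∀ p q q' → (p *P (q ++ q')) ≋ ((p *P q) ++ (p *P q'))
  *P-++ʳ [] q q' = ≋-refl
  *P-++ʳ (t ∷ p) q q' = PR.begin
    mulT t (q ++ q') ++ (p *P (q ++ q')) PR.≈⟨ ++-cong (≡⇒≋ (mulT-++ t q q')) (*P-++ʳ p q q') ⟩
    (mulT t q ++ mulT t q') ++ ((p *P q) ++ (p *P q')) PR.≈⟨ ++-interchange (mulT t q) (mulT t q') (p *P q) (p *P q') ⟩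
    (mulT t q ++ (p *P q)) ++ (mulT t q' ++ (p *P q')) PR.∎

  _·T_ : Term → Term → Term
  (a , α) ·T (b , β) = (a * b , α ⊕ β)

  mulT-cons : ∀ t s q → mulT t (s ∷ q) ≡ (t ·T s) ∷ mulT t q
  mulT-cons (a , α) (b , β) q = P.refl

  single-shift-at : ∀ a α b β ν → Dec (β ≡ ν) → coeff ((a * b , α ⊕ β) ∷ []) (α ⊕ ν) ≈ a * coeff ((b , β) ∷ []) ν
  single-shift-at a α b β .β (yes P.refl) = trans (coeff-single-yes (a * b) (α ⊕ β)) (*-congˡ (sym (coeff-single-yes b β)))
  single-shift-at a α b β ν (no ne) = trans (coeff-single-no (a * b) (α ⊕ β) (α ⊕ ν) (λ e → ne (⊕-cancelˡ α β ν e)))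
                 (sym (trans (*-congˡ (coeff-single-no b β ν ne)) (zeroʳ _)))

  single-shift : ∀ a α b β ν → coeff ((a * b , α ⊕ β) ∷ []) (α ⊕ ν) ≈ a * coeff ((b , β) ∷ []) ν
  single-shift a α b β ν = single-shift-at a α b β ν (≡-dec ℕ._≟_ β ν)

  coeff-mulT-shift : ∀ a α q ν → coeff (mulT (a , α) q) (α ⊕ ν) ≈ a * coeff q ν
  coeff-mulT-shift a α [] ν = sym (zeroʳ _)
  coeff-mulT-shift a α ((b , β) ∷ q) ν = begin
    coeff ((a * b , α ⊕ β) ∷ mulT (a , α) q) (α ⊕ ν) ≈⟨ coeff-cons (a * b) (α ⊕ β) (mulT (a , α) q) (α ⊕ ν) ⟩
    coeff ((a * b , α ⊕ β) ∷ []) (α ⊕ ν) + coeff (mulT (a , α) q) (α ⊕ ν) ≈⟨ +-cong (single-shift a α b β ν) (coeff-mulT-shift a α q ν) ⟩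
    a * coeff ((b , β) ∷ []) ν + a * coeff q ν ≈⟨ sym (distribˡ _ _ _) ⟩
    a * (coeff ((b , β) ∷ []) ν + coeff q ν) ≈⟨ *-congˡ (sym (coeff-cons b β q ν)) ⟩
    a * coeff ((b , β) ∷ q) ν ∎

  coeff-mulT-off : ∀ a α q μ → (∀ ν → α ⊕ ν ≢ μ) → coeff (mulT (a , α) q) μ ≈ 0#
  coeff-mulT-off a α [] μ h = refl
  coeff-mulT-off a α ((b , β) ∷ q) μ h = begin
    coeff ((a * b , α ⊕ β) ∷ mulT (a , α) q) μ ≈⟨ coeff-cons (a * b) (α ⊕ β) (mulT (a , α) q) μ ⟩
    coeff ((a * b , α ⊕ β) ∷ []) μ + coeff (mulT (a , α) q) μ ≈⟨ +-cong (coeff-single-no _ _ _ (h β)) (coeff-mulT-off a α q μ h) ⟩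
    0# + 0# ≈⟨ +-identityˡ _ ⟩
    0# ∎

  mulT-cong : ∀ t {q q'} → q ≋ q' → mulT t q ≋ mulT t q'
  mulT-cong (a , α) {q} {q'} (mk e) = mk λ μ → by-case μ (≡-dec ℕ._≟_ (α ⊕ (μ ∸v α)) μ)
    where
    by-case : ∀ μ → Dec (α ⊕ (μ ∸v α) ≡ μ) → coeff (mulT (a , α) q) μ ≈ coeff (mulT (a , α) q') μ
    by-case μ (yes eq) = P.subst (λ z → coeff (mulT (a , α) q) z ≈ coeff (mulT (a , α) q') z) eq
      (trans (coeff-mulT-shift a α q (μ ∸v α)) (trans (*-congˡ (e _)) (sym (coeff-mulT-shift a α q' (μ ∸v α)))))
    by-case μ (no ne) = trans (coeff-mulT-off a α q μ not-multiple) (sym (coeff-mulT-off a α q' μ not-multiple))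
      where
      not-multiple : ∀ ν → α ⊕ ν ≢ μ
      not-multiple ν eq = ne (P.subst (λ z → α ⊕ z ≡ μ) (⊕-∸v α ν μ eq) eq)

  *P-congʳ : ∀ p {q q'} → q ≋ q' → (p *P q) ≋ (p *P q')
  *P-congʳ [] e = ≋-refl
  *P-congʳ (t ∷ p) e = ++-cong (mulT-cong t e) (*P-congʳ p e)

  single-mul : ∀ t q → PW (q *P (t ∷ [])) (mulT t q)
  single-mul t [] = pw[]
  single-mul (a , α) ((b , β) ∷ q) = pw∷ (*-comm b a) (⊕-comm β α) (single-mul (a , α) q)

  *P-comm : ∀ p q → (p *P q) ≋ (q *P p)
  *P-comm [] q = ≡⇒≋ (P.sym (*P-[]ʳ q))
  *P-comm (t ∷ p) q = PR.begin
    mulT t q ++ (p *P q) PR.≈⟨ ++-cong (≋-sym (PW⇒≋ (single-mul t q))) (*P-comm p q) ⟩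
    (q *P (t ∷ [])) ++ (q *P p) PR.≈⟨ ≋-sym (*P-++ʳ q (t ∷ []) p) ⟩
    q *P (t ∷ p) PR.∎

  *P-congˡ : ∀ {p p'} q → p ≋ p' → (p *P q) ≋ (p' *P q)
  *P-congˡ {p} {p'} q e = ≋-trans (*P-comm p q) (≋-trans (*P-congʳ q e) (*P-comm q p'))

  mulT-mulT : ∀ t s r → PW (mulT t (mulT s r)) (mulT (t ·T s) r)
  mulT-mulT t s [] = pw[]
  mulT-mulT (a , α) (b , β) ((x , γ) ∷ r) = pw∷ (sym (*-assoc a b x)) (P.sym (⊕-assoc α β γ)) (mulT-mulT (a , α) (b , β) r)

  mulT-*P : ∀ t q r → ((mulT t q) *P r) ≋ mulT t (q *P r)
  mulT-*P t [] r = ≋-refl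
  mulT-*P t (s ∷ q) r = PR.begin
    (mulT t (s ∷ q)) *P r PR.≡⟨ P.cong (_*P r) (mulT-cons t s q) ⟩
    mulT (t ·T s) r ++ ((mulT t q) *P r) PR.≈⟨ ++-cong (≋-sym (PW⇒≋ (mulT-mulT t s r))) (mulT-*P t q r) ⟩
    mulT t (mulT s r) ++ mulT t (q *P r) PR.≡⟨ P.sym (mulT-++ t (mulT s r) (q *P r)) ⟩
    mulT t ((s ∷ q) *P r) PR.∎

  *P-assoc : ∀ p q r → ((p *P q) *P r) ≋ (p *P (q *P r))
  *P-assoc [] q r = ≋-refl
  *P-assoc (t ∷ p) q r = PR.begin
    (mulT t q ++ (p *P q)) *P r PR.≡⟨ *P-++ˡ (mulT t q) (p *P q) r ⟩
    ((mulT t q) *P r) ++ ((p *P q) *P r) PR.≈⟨ ++-cong (mulT-*P t q r) (*P-assoc p q r) ⟩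
    mulT t (q *P r) ++ (p *P (q *P r)) PR.∎

  dT : Fin m → Term → Term
  dT k (a , μ) = (nc (lookup μ k) * a , lower μ k)

  ∂-cons : ∀ k t p → ∂ k (t ∷ p) ≡ dT k t ∷ ∂ k p
  ∂-cons k (a , μ) p = P.refl

  ∂-++ : ∀ k p q → ∂ k (p ++ q) ≡ (∂ k p ++ ∂ k q)
  ∂-++ k p q = ListP.map-++ _ p q

  zero-term : ∀ a μ p → a ≈ 0# → ((a , μ) ∷ p) ≋ p
  zero-term a μ p e = mk λ ν → trans (coeff-cons a μ p ν) (trans (+-congʳ (lem ν)) (+-identityˡ _))
    where
    lem : ∀ ν → coeff ((a , μ) ∷ []) ν ≈ 0#
    lem ν with ≡-dec ℕ._≟_ μ ν
    ... | yes _ = trans (+-identityʳ _) e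
    ... | no _ = refl

  single-add-at : ∀ b c μ ν → Dec (μ ≡ ν) → coeff ((b + c , μ) ∷ []) ν ≈ coeff ((b , μ) ∷ []) ν + coeff ((c , μ) ∷ []) ν
  single-add-at b c μ .μ (yes P.refl) = trans (coeff-single-yes _ μ) (sym (+-cong (coeff-single-yes b μ) (coeff-single-yes c μ)))
  single-add-at b c μ ν (no ne) = trans (coeff-single-no _ μ ν ne) (sym (trans (+-cong (coeff-single-no b μ ν ne) (coeff-single-no c μ ν ne)) (+-identityˡ _)))

  split-term : ∀ a b c μ → a ≈ b + c → ((a , μ) ∷ []) ≋ ((b , μ) ∷ (c , μ) ∷ [])
  split-term a b c μ e = mk λ ν → begin
    coeff ((a , μ) ∷ []) ν ≈⟨ get (PW⇒≋ (pw∷ {μ = μ} e P.refl pw[])) ν ⟩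
    coeff ((b + c , μ) ∷ []) ν ≈⟨ single-add-at b c μ ν (≡-dec ℕ._≟_ μ ν) ⟩
    coeff ((b , μ) ∷ []) ν + coeff ((c , μ) ∷ []) ν ≈⟨ sym (coeff-cons b μ ((c , μ) ∷ []) ν) ⟩
    coeff ((b , μ) ∷ (c , μ) ∷ []) ν ∎

  leib-term : ∀ k t s → (dT k (t ·T s) ∷ []) ≋ ((dT k t ·T s) ∷ (t ·T dT k s) ∷ [])
  leib-term k (a , α) (b , β) = go (lookup α k) P.refl (lookup β k) P.refl
    where
    L : lookup (α ⊕ β) k ≡ lookup α k ℕ.+ lookup β k
    L = lookup-⊕ α β k
    go : ∀ x → lookup α k ≡ x → ∀ y → lookup β k ≡ y →
         (dT k ((a , α) ·T (b , β)) ∷ []) ≋ ((dT k (a , α) ·T (b , β)) ∷ ((a , α) ·T dT k (b , β)) ∷ [])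
    go zero ex y ey = ≋-sym (≋-trans (zero-term _ _ _ c0) (PW⇒≋ (pw∷ ceq (P.sym (lower-⊕ʳ-zero α β k ex)) pw[])))
      where
      c0 : nc (lookup α k) * a * b ≈ 0#
      c0 = trans (*-congʳ (trans (*-congʳ (reflexive (P.cong nc ex))) (zeroˡ _))) (zeroˡ _)
      ceq : a * (nc (lookup β k) * b) ≈ nc (lookup (α ⊕ β) k) * (a * b)
      ceq = trans (solve 3 (λ a x b → a :* (x :* b) := x :* (a :* b)) refl a (nc (lookup β k)) b)
                  (*-congʳ (reflexive (P.cong nc (P.sym (P.trans L (P.cong (ℕ._+ lookup β k) ex))))))
    go (suc x) ex zero ey = ≋-trans (PW⇒≋ (pw∷ ceq (lower-⊕ˡ α β k ex) pw[])) (≋-sym (++-idʳ _ _ (≋-trans (zero-term _ _ _ c0) ≋-refl)))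
      where
      c0 : a * (nc (lookup β k) * b) ≈ 0#
      c0 = trans (*-congˡ (trans (*-congʳ (reflexive (P.cong nc ey))) (zeroˡ _))) (zeroʳ _)
      ceq : nc (lookup (α ⊕ β) k) * (a * b) ≈ nc (lookup α k) * a * b
      ceq = trans (*-congʳ (reflexive (P.cong nc (P.trans L (P.trans (P.cong (lookup α k ℕ.+_) ey) (ℕP.+-identityʳ _))))))
                  (sym (*-assoc _ _ _))
    go (suc x) ex (suc y) ey = ≋-trans (≡⇒≋ (P.cong (λ z → (nc (lookup (α ⊕ β) k) * (a * b) , z) ∷ []) (lower-⊕ˡ α β k ex)))
      (≋-trans (split-term _ _ _ (lower α k ⊕ β) ceq) (PW⇒≋ (pw∷ refl P.refl (pw∷ refl (P.trans (P.sym (lower-⊕ˡ α β k ex)) (lower-⊕ʳ α β k ey)) pw[]))))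
      where
      ceq : nc (lookup (α ⊕ β) k) * (a * b) ≈ nc (lookup α k) * a * b + a * (nc (lookup β k) * b)
      ceq = trans (*-congʳ (trans (reflexive (P.cong nc L)) (nc-+ (lookup α k) (lookup β k))))
                  (solve 4 (λ x y a b → (x :+ y) :* (a :* b) := x :* a :* b :+ a :* (y :* b)) refl (nc (lookup α k)) (nc (lookup β k)) a b)

  leib-mulT : ∀ k t q → ∂ k (mulT t q) ≋ (mulT (dT k t) q ++ mulT t (∂ k q))
  leib-mulT k t [] = ≋-refl
  leib-mulT k t (s ∷ q) = PR.begin
    ∂ k (mulT t (s ∷ q)) PR.≡⟨ P.cong (∂ k) (mulT-cons t s q) ⟩
    ∂ k ((t ·T s) ∷ mulT t q) PR.≡⟨ ∂-cons k (t ·T s) (mulT t q) ⟩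
    (dT k (t ·T s) ∷ []) ++ ∂ k (mulT t q) PR.≈⟨ ++-cong (leib-term k t s) (leib-mulT k t q) ⟩
    ((dT k t ·T s) ∷ []) ++ ((t ·T dT k s) ∷ []) ++ (mulT (dT k t) q ++ mulT t (∂ k q)) PR.≈⟨ ++-interchange ((dT k t ·T s) ∷ []) ((t ·T dT k s) ∷ []) (mulT (dT k t) q) (mulT t (∂ k q)) ⟩
    (((dT k t ·T s) ∷ []) ++ mulT (dT k t) q) ++ (((t ·T dT k s) ∷ []) ++ mulT t (∂ k q)) PR.≡⟨ P.cong₂ _++_ (P.sym (mulT-cons (dT k t) s q)) (P.trans (P.sym (mulT-cons t (dT k s) (∂ k q))) (P.cong (mulT t) (P.sym (∂-cons k s q)))) ⟩
    mulT (dT k t) (s ∷ q) ++ mulT t (∂ k (s ∷ q)) PR.∎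

  leibniz : ∀ k p q → ∂ k (p *P q) ≋ ((∂ k p *P q) ++ (p *P ∂ k q))
  leibniz k [] q = ≋-refl
  leibniz k (t ∷ p) q = PR.begin
    ∂ k (mulT t q ++ (p *P q)) PR.≡⟨ ∂-++ k (mulT t q) (p *P q) ⟩
    ∂ k (mulT t q) ++ ∂ k (p *P q) PR.≈⟨ ++-cong (leib-mulT k t q) (leibniz k p q) ⟩
    (mulT (dT k t) q ++ mulT t (∂ k q)) ++ ((∂ k p *P q) ++ (p *P ∂ k q)) PR.≈⟨ ++-interchange (mulT (dT k t) q) (mulT t (∂ k q)) (∂ k p *P q) (p *P ∂ k q) ⟩
    (mulT (dT k t) q ++ (∂ k p *P q)) ++ (mulT t (∂ k q) ++ (p *P ∂ k q)) PR.≡⟨ P.cong (λ z → (z *P q) ++ ((t ∷ p) *P ∂ k q)) (P.sym (∂-cons k t p)) ⟩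
    (∂ k (t ∷ p) *P q) ++ ((t ∷ p) *P ∂ k q) PR.∎



module LinearFormsAndDerivations {c ℓ} (K : Field c ℓ) (m : ℕ) where
  import Data.Nat as ℕ
  open import Data.Fin as Fin using (Fin)
  open import Data.Vec as Vec using (Vec; replicate)
  import Data.Vec.Properties as VecP
  open import Data.Vec.Properties using (≡-dec)
  open import Data.List as List using (List; []; _∷_; _++_; map; foldr; allFin)
  import Data.List.Properties as ListP
  open import Data.List.Membership.Propositional using (_∈_)
  open import Data.List.Membership.Propositional.Properties using (∈-allFin)
  open import Data.List.Relation.Unary.Any using (here; there)
  open import Data.List.Relation.Unary.Unique.Propositional using (Unique)
  open import Data.List.Relation.Unary.Unique.Propositional.Properties using (allFin⁺)
  open import Data.Product using (_,_)
  open import Relation.Nullary using (yes; no; Dec)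
  open import Relation.Binary.Definitions using (DecidableEquality)
  open import Relation.Binary.PropositionalEquality as P using (_≡_; _≢_)
  import Relation.Binary.Reasoning.Setoid as SetoidReasoning
  open ExponentVectors

  open FieldArithmetic K
  open FiniteSums K
  open PolynomialRing K m
  open Poly K m
  open SetoidReasoning setoid

  SP : ∀ {I : Set} → (I → Pol) → List I → Pol
  SP f xs = foldr (λ k s → f k ++ s) [] xs

  module _ {I : Set} where
    SP-cong : ∀ {f g : I → Pol} xs → (∀ i → f i ≋ g i) → SP f xs ≋ SP g xs
    SP-cong [] e = ≋-refl
    SP-cong (x ∷ xs) e = ++-cong (e x) (SP-cong xs e)

    coeff-SP : ∀ (f : I → Pol) xs μ → coeff (SP f xs) μ ≈ ΣL (λ i → coeff (f i) μ) xs
    coeff-SP f [] μ = refl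
    coeff-SP f (x ∷ xs) μ = trans (coeff-++ (f x) (SP f xs) μ) (+-congˡ (coeff-SP f xs μ))

    SP-++ : ∀ (f g : I → Pol) xs → SP (λ i → f i ++ g i) xs ≋ (SP f xs ++ SP g xs)
    SP-++ f g xs = mk λ μ → trans (coeff-SP _ xs μ) (trans (ΣL-cong xs (λ i → coeff-++ (f i) (g i) μ))
       (trans (ΣL-+ _ _ xs) (sym (trans (coeff-++ (SP f xs) (SP g xs) μ) (+-cong (coeff-SP f xs μ) (coeff-SP g xs μ))))))

    SP-0 : ∀ {f : I → Pol} xs → (∀ i → f i ≋ []) → SP f xs ≋ []
    SP-0 xs e = mk λ μ → trans (coeff-SP _ xs μ) (ΣL-0 xs (λ i → get (e i) μ))

    SP-*ʳ : ∀ (f : I → Pol) xs q → (SP f xs *P q) ≡ SP (λ i → f i *P q) xs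
    SP-*ʳ f [] q = P.refl
    SP-*ʳ f (x ∷ xs) q = P.trans (*P-++ˡ (f x) (SP f xs) q) (P.cong ((f x *P q) ++_) (SP-*ʳ f xs q))

    SP-*ˡ : ∀ q (f : I → Pol) xs → (q *P SP f xs) ≋ SP (λ i → q *P f i) xs
    SP-*ˡ q f xs = ≋-trans (*P-comm q (SP f xs)) (≋-trans (≡⇒≋ (SP-*ʳ f xs q)) (SP-cong xs (λ i → *P-comm (f i) q)))

    SP-delta : (_≟_ : DecidableEquality I) → ∀ {f : I → Pol} xs k → Unique xs → k ∈ xs →
               (∀ i → i ≢ k → f i ≋ []) → SP f xs ≋ f k
    SP-delta _≟_ xs k u mem h = mk λ μ → trans (coeff-SP _ xs μ) (ΣL-delta _≟_ xs k u mem (λ i ne → get (h i ne) μ))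

  z0 : Monomial
  z0 = replicate m 0

  const : Carrier → Pol
  const a = (a , z0) ∷ []

  scale : Carrier → Pol → Pol
  scale a p = map (λ { (b , β) → (a * b , β) }) p

  mulT-z0 : ∀ a p → PW (mulT (a , z0) p) (scale a p)
  mulT-z0 a [] = pw[]
  mulT-z0 a ((b , β) ∷ p) = pw∷ refl (⊕-identityˡ β) (mulT-z0 a p)

  const-mul : ∀ a p → (const a *P p) ≋ scale a p
  const-mul a p = ≋-trans (++-idʳ (mulT (a , z0) p) [] ≋-refl) (PW⇒≋ (mulT-z0 a p))

  coeff-scale : ∀ a p μ → coeff (scale a p) μ ≈ a * coeff p μ
  coeff-scale a [] μ = sym (zeroʳ _)
  coeff-scale a ((b , β) ∷ p) μ = begin
    coeff ((a * b , β) ∷ scale a p) μ ≈⟨ coeff-cons (a * b) β (scale a p) μ ⟩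
    coeff ((a * b , β) ∷ []) μ + coeff (scale a p) μ ≈⟨ +-cong (lem (≡-dec ℕ._≟_ β μ)) (coeff-scale a p μ) ⟩
    a * coeff ((b , β) ∷ []) μ + a * coeff p μ ≈⟨ sym (distribˡ _ _ _) ⟩
    a * (coeff ((b , β) ∷ []) μ + coeff p μ) ≈⟨ *-congˡ (sym (coeff-cons b β p μ)) ⟩
    a * coeff ((b , β) ∷ p) μ ∎
    where
    lem : Dec (β ≡ μ) → coeff ((a * b , β) ∷ []) μ ≈ a * coeff ((b , β) ∷ []) μ
    lem (yes P.refl) = trans (coeff-single-yes _ β) (*-congˡ (sym (coeff-single-yes b β)))
    lem (no ne) = trans (coeff-single-no _ β μ ne) (sym (trans (*-congˡ (coeff-single-no b β μ ne)) (zeroʳ _)))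

  coeff-constmul : ∀ a p μ → coeff (const a *P p) μ ≈ a * coeff p μ
  coeff-constmul a p μ = trans (get (const-mul a p) μ) (coeff-scale a p μ)

  const-add : ∀ a b p → ((const a *P p) ++ (const b *P p)) ≋ (const (a + b) *P p)
  const-add a b p = mk λ μ → trans (coeff-++ (const a *P p) (const b *P p) μ)
    (trans (+-cong (coeff-constmul a p μ) (coeff-constmul b p μ)) (trans (sym (distribʳ _ _ _)) (sym (coeff-constmul (a + b) p μ))))

  const-zero : ∀ a p → a ≈ 0# → (const a *P p) ≋ []
  const-zero a p e = mk λ μ → trans (coeff-constmul a p μ) (trans (*-congʳ e) (zeroˡ _))

  const-0 : ∀ {a} → a ≈ 0# → const a ≋ []
  const-0 e = zero-term _ _ _ e

  ∂-const : ∀ k a → ∂ k (const a) ≋ []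
  ∂-const k a = zero-term _ _ _ (trans (*-congʳ (reflexive (P.cong nc (VecP.lookup-replicate k 0)))) (zeroˡ _))

  ∂-SP : ∀ {I : Set} k (f : I → Pol) xs → ∂ k (SP f xs) ≡ SP (λ i → ∂ k (f i)) xs
  ∂-SP k f [] = P.refl
  ∂-SP k f (x ∷ xs) = P.trans (∂-++ k (f x) (SP f xs)) (P.cong (∂ k (f x) ++_) (∂-SP k f xs))

  map≡SP : ∀ {I : Set} (g : I → Term) xs → map g xs ≡ SP (λ i → g i ∷ []) xs
  map≡SP g [] = P.refl
  map≡SP g (x ∷ xs) = P.cong (g x ∷_) (map≡SP g xs)

  linear≡ : ∀ a → linear a ≡ SP (λ j → (a j , unit j) ∷ []) (allFin m)
  linear≡ a = map≡SP (λ k → (a k , unit k)) (allFin m)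


  ∂-single-same : ∀ k b → ∂ k ((b , unit k) ∷ []) ≋ const b
  ∂-single-same k b = PW⇒≋ (pw∷ (trans (*-congʳ (reflexive (P.cong nc (lookup-unit-same k)))) (trans (*-congʳ (+-identityʳ _)) (*-identityˡ _))) (lower-unit k) pw[])

  ∂-single-diff : ∀ k j b → j ≢ k → ∂ k ((b , unit j) ∷ []) ≋ []
  ∂-single-diff k j b ne = zero-term _ _ _ (trans (*-congʳ (reflexive (P.cong nc (lookup-unit-diff j k ne)))) (zeroˡ _))

  ∂-linear : ∀ k a → ∂ k (linear a) ≋ const (a k)
  ∂-linear k a = PR.begin
    ∂ k (linear a) PR.≡⟨ P.cong (∂ k) (linear≡ a) ⟩
    ∂ k (SP (λ j → (a j , unit j) ∷ []) (allFin m)) PR.≡⟨ ∂-SP k _ (allFin m) ⟩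
    SP (λ j → ∂ k ((a j , unit j) ∷ [])) (allFin m) PR.≈⟨ SP-delta Fin._≟_ (allFin m) k (allFin⁺ m) (∈-allFin k) (λ j ne → ∂-single-diff k j (a j) ne) ⟩
    ∂ k ((a k , unit k) ∷ []) PR.≈⟨ ∂-single-same k (a k) ⟩
    const (a k) PR.∎

  linear-cong : ∀ {a b} → (∀ j → a j ≈ b j) → linear a ≋ linear b
  linear-cong {a} {b} e = ≋-trans (≡⇒≋ (linear≡ a)) (≋-trans (SP-cong (allFin m) (λ j → PW⇒≋ (pw∷ (e j) P.refl pw[]))) (≡⇒≋ (P.sym (linear≡ b))))

  coeff-linear-unit : ∀ a k → coeff (linear a) (unit k) ≈ a k
  coeff-linear-unit a k = begin
    coeff (linear a) (unit k) ≡⟨ P.cong (λ z → coeff z (unit k)) (linear≡ a) ⟩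
    coeff (SP (λ j → (a j , unit j) ∷ []) (allFin m)) (unit k) ≈⟨ coeff-SP _ (allFin m) (unit k) ⟩
    ΣL (λ j → coeff ((a j , unit j) ∷ []) (unit k)) (allFin m) ≈⟨ ΣL-delta Fin._≟_ (allFin m) k (allFin⁺ m) (∈-allFin k) (λ j ne → coeff-single-no (a j) (unit j) (unit k) (λ e → ne (unit-injective j k e))) ⟩
    coeff ((a k , unit k) ∷ []) (unit k) ≈⟨ coeff-single-yes (a k) (unit k) ⟩
    a k ∎

  linear-homog : ∀ a μ → Vec.sum μ ≢ 1 → coeff (linear a) μ ≈ 0#
  linear-homog a μ ne = trans (reflexive (P.cong (λ z → coeff z μ) (linear≡ a))) (trans (coeff-SP _ (allFin m) μ)
    (ΣL-0 (allFin m) (λ j → coeff-single-no (a j) (unit j) μ (λ e → ne (P.trans (P.cong Vec.sum (P.sym e)) (sum-unit j))))))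

  linear-add : ∀ a b → (linear a ++ linear b) ≋ linear (λ j → a j + b j)
  linear-add a b = PR.begin
    linear a ++ linear b PR.≡⟨ P.cong₂ _++_ (linear≡ a) (linear≡ b) ⟩
    SP (λ j → (a j , unit j) ∷ []) (allFin m) ++ SP (λ j → (b j , unit j) ∷ []) (allFin m) PR.≈⟨ ≋-sym (SP-++ _ _ (allFin m)) ⟩
    SP (λ j → (a j , unit j) ∷ (b j , unit j) ∷ []) (allFin m) PR.≈⟨ SP-cong (allFin m) (λ j → ≋-sym (split-term _ (a j) (b j) (unit j) refl)) ⟩
    SP (λ j → (a j + b j , unit j) ∷ []) (allFin m) PR.≡⟨ P.sym (linear≡ _) ⟩
    linear (λ j → a j + b j) PR.∎

  linear-0 : ∀ a → (∀ j → a j ≈ 0#) → linear a ≋ []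
  linear-0 a e = ≋-trans (≡⇒≋ (linear≡ a)) (SP-0 (allFin m) (λ j → zero-term _ _ _ (e j)))

  SP-linear : ∀ {I : Set} (g : I → Fin m → Carrier) xs → SP (λ i → linear (g i)) xs ≋ linear (λ j → ΣL (λ i → g i j) xs)
  SP-linear g [] = ≋-sym (linear-0 _ (λ j → refl))
  SP-linear g (x ∷ xs) = ≋-trans (++-cong ≋-refl (SP-linear g xs)) (linear-add _ _)

  scale-linear : ∀ c a → (const c *P linear a) ≋ linear (λ j → c * a j)
  scale-linear c a = ≋-trans (const-mul c (linear a)) (≡⇒≋ (P.sym (ListP.map-∘ (allFin m))))

  D : (Fin m → Pol) → Pol → Pol
  D Q p = sumP (λ k → Q k *P ∂ k p)

  D-leib : ∀ Q p q → D Q (p *P q) ≋ ((D Q p *P q) ++ (p *P D Q q))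
  D-leib Q p q = PR.begin
    SP (λ k → Q k *P ∂ k (p *P q)) (allFin m) PR.≈⟨ SP-cong (allFin m) (λ k → ≋-trans (*P-congʳ (Q k) (leibniz k p q)) (*P-++ʳ (Q k) _ _)) ⟩
    SP (λ k → (Q k *P (∂ k p *P q)) ++ (Q k *P (p *P ∂ k q))) (allFin m) PR.≈⟨ SP-++ _ _ (allFin m) ⟩
    SP (λ k → Q k *P (∂ k p *P q)) (allFin m) ++ SP (λ k → Q k *P (p *P ∂ k q)) (allFin m)
      PR.≈⟨ ++-cong (SP-cong (allFin m) (λ k → ≋-sym (*P-assoc (Q k) (∂ k p) q)))
                    (SP-cong (allFin m) (λ k → ≋-trans (≋-sym (*P-assoc (Q k) p (∂ k q))) (≋-trans (*P-congˡ (∂ k q) (*P-comm (Q k) p)) (*P-assoc p (Q k) (∂ k q))))) ⟩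
    SP (λ k → (Q k *P ∂ k p) *P q) (allFin m) ++ SP (λ k → p *P (Q k *P ∂ k q)) (allFin m)
      PR.≈⟨ ++-cong (≡⇒≋ (P.sym (SP-*ʳ _ (allFin m) q))) (≋-sym (SP-*ˡ p _ (allFin m))) ⟩
    (D Q p *P q) ++ (p *P D Q q) PR.∎

  D-const : ∀ Q a → D Q (const a) ≋ []
  D-const Q a = SP-0 (allFin m) (λ k → ≋-trans (*P-congʳ (Q k) (∂-const k a)) (≡⇒≋ (*P-[]ʳ (Q k))))

  D-linear : ∀ Q b → D Q (linear b) ≋ SP (λ k → const (b k) *P Q k) (allFin m)
  D-linear Q b = SP-cong (allFin m) (λ k → ≋-trans (*P-congʳ (Q k) (∂-linear k b)) (*P-comm (Q k) (const (b k))))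

  D-prod : ∀ {E : Set} Q (g : E → Pol) (cc : E → Carrier) es →
           (∀ e → e ∈ es → D Q (g e) ≋ (const (cc e) *P g e)) →
           D Q (prodP (map g es)) ≋ (const (ΣL cc es) *P prodP (map g es))
  D-prod Q g cc [] h = ≋-trans (D-const Q 1#) (≋-sym (const-zero _ _ refl))
  D-prod Q g cc (e ∷ es) h = PR.begin
    D Q (g e *P Π) PR.≈⟨ D-leib Q (g e) Π ⟩
    (D Q (g e) *P Π) ++ (g e *P D Q Π) PR.≈⟨ ++-cong (*P-congˡ Π (h e (here P.refl))) (*P-congʳ (g e) (D-prod Q g cc es (λ e' m → h e' (there m)))) ⟩
    ((const (cc e) *P g e) *P Π) ++ (g e *P (const (ΣL cc es) *P Π)) PR.≈⟨ ++-cong (*P-assoc (const (cc e)) (g e) Π)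
         (≋-trans (≋-sym (*P-assoc (g e) (const (ΣL cc es)) Π)) (≋-trans (*P-congˡ Π (*P-comm (g e) (const (ΣL cc es)))) (*P-assoc (const (ΣL cc es)) (g e) Π))) ⟩
    (const (cc e) *P (g e *P Π)) ++ (const (ΣL cc es) *P (g e *P Π)) PR.≈⟨ const-add _ _ _ ⟩
    const (cc e + ΣL cc es) *P (g e *P Π) PR.∎
    where Π = prodP (map g es)


module Evaluation {c ℓ} (K : Field c ℓ) (m : ℕ) where
  open import Data.Nat as ℕ using (zero; suc; z≤n; s≤s)
  import Data.Nat.Properties as ℕP
  open import Data.Fin as Fin using (Fin)
  open import Data.Vec as Vec using (Vec; replicate)
  open import Data.Vec.Properties using (≡-dec)
  open import Data.List as List using ([]; _∷_; _++_; map; foldr; allFin; length)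
  open import Data.Product using (_,_; proj₁; proj₂)
  open import Relation.Nullary using (yes; no; Dec)
  open import Data.Empty using (⊥-elim)
  open import Relation.Binary.PropositionalEquality as P using (_≡_; _≢_)
  open import Function using (_∘_)
  import Relation.Binary.Reasoning.Setoid as SetoidReasoning
  open ExponentVectors

  open FieldArithmetic K
  open FiniteSums K
  open PolynomialRing K m
  open LinearFormsAndDerivations K m
  open Poly K m
  open SetoidReasoning setoid

  pow : Carrier → ℕ → Carrier
  pow x zero = 1#
  pow x (suc n) = x * pow x n

  pow-+ : ∀ x a b → pow x (a ℕ.+ b) ≈ pow x a * pow x b
  pow-+ x zero b = sym (*-identityˡ _)
  pow-+ x (suc a) b = trans (*-congˡ (pow-+ x a b)) (sym (*-assoc _ _ _))

  mon : ∀ {n} → Vec ℕ n → (Fin n → Carrier) → Carrier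
  mon Vec.[] u = 1#
  mon (x Vec.∷ μ) u = pow (u Fin.zero) x * mon μ (u ∘ Fin.suc)

  mon-⊕ : ∀ {n} (α β : Vec ℕ n) u → mon (α ⊕ β) u ≈ mon α u * mon β u
  mon-⊕ Vec.[] Vec.[] u = sym (*-identityʳ _)
  mon-⊕ (a Vec.∷ α) (b Vec.∷ β) u = trans (*-cong (pow-+ _ a b) (mon-⊕ α β (u ∘ Fin.suc)))
    (solve 4 (λ p q r s → (p :* q) :* (r :* s) := (p :* r) :* (q :* s)) refl _ _ _ _)

  mon-z0 : ∀ {n} u → mon (replicate n 0) u ≈ 1#
  mon-z0 {zero} u = refl
  mon-z0 {suc n} u = trans (*-identityˡ _) (mon-z0 {n} (u ∘ Fin.suc))

  mon-unit : ∀ {n} (j : Fin n) u → mon (unit j) u ≈ u j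
  mon-unit Fin.zero u = trans (*-cong (*-identityʳ _) (mon-z0 (u ∘ Fin.suc))) (*-identityʳ _)
  mon-unit (Fin.suc j) u = trans (*-identityˡ _) (mon-unit j (u ∘ Fin.suc))

  module _ (u : Fin m → Carrier) where
    ev : Pol → Carrier
    ev p = foldr (λ t s → proj₁ t * mon (proj₂ t) u + s) 0# p

    ev-++ : ∀ p q → ev (p ++ q) ≈ ev p + ev q
    ev-++ [] q = sym (+-identityˡ _)
    ev-++ (t ∷ p) q = trans (+-congˡ (ev-++ p q)) (sym (+-assoc _ _ _))

    ev-mulT : ∀ a α q → ev (mulT (a , α) q) ≈ a * mon α u * ev q
    ev-mulT a α [] = sym (zeroʳ _)
    ev-mulT a α ((b , β) ∷ q) = trans (+-cong (*-congˡ (mon-⊕ α β u)) (ev-mulT a α q))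
      (solve 5 (λ a b x y e → (a :* b) :* (x :* y) :+ a :* x :* e := a :* x :* (b :* y :+ e)) refl a b (mon α u) (mon β u) (ev q))

    ev-*P : ∀ p q → ev (p *P q) ≈ ev p * ev q
    ev-*P [] q = sym (zeroˡ _)
    ev-*P ((a , α) ∷ p) q = trans (ev-++ (mulT (a , α) q) (p *P q)) (trans (+-cong (ev-mulT a α q) (ev-*P p q)) (sym (distribʳ _ _ _)))

    ev-const : ∀ a → ev (const a) ≈ a
    ev-const a = trans (+-identityʳ _) (trans (*-congˡ (mon-z0 u)) (*-identityʳ _))

    ev-SP : ∀ {I : Set} (f : I → Pol) xs → ev (SP f xs) ≈ ΣL (λ i → ev (f i)) xs
    ev-SP f [] = refl
    ev-SP f (x ∷ xs) = trans (ev-++ (f x) (SP f xs)) (+-congˡ (ev-SP f xs))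

    ev-linear : ∀ a → ev (linear a) ≈ ΣL (λ j → a j * u j) (allFin m)
    ev-linear a = trans (reflexive (P.cong ev (linear≡ a))) (trans (ev-SP _ (allFin m))
      (ΣL-cong (allFin m) (λ j → trans (+-identityʳ _) (*-congˡ (mon-unit j u)))))

    -- Removing all terms with monomial μ splits off coeff p μ · u^μ; by induction
    -- on the length this shows that a polynomial ≋ 0 has value 0.
    rem : Monomial → Pol → Pol
    rem μ [] = []
    rem μ ((a , ν) ∷ p) with ≡-dec ℕ._≟_ ν μ
    ... | yes _ = rem μ p
    ... | no _ = (a , ν) ∷ rem μ p

    ev-rem : ∀ μ p → ev p ≈ coeff p μ * mon μ u + ev (rem μ p)
    ev-rem μ [] = sym (trans (+-identityʳ _) (zeroˡ _))
    ev-rem μ ((a , ν) ∷ p) with ≡-dec ℕ._≟_ ν μ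
    ... | yes P.refl = trans (+-congˡ (ev-rem ν p)) (solve 4 (λ a x c e → a :* x :+ (c :* x :+ e) := (a :+ c) :* x :+ e) refl a (mon ν u) (coeff p ν) (ev (rem ν p)))
    ... | no _ = trans (+-congˡ (ev-rem μ p)) (solve 4 (λ y c x e → y :+ (c :* x :+ e) := c :* x :+ (y :+ e)) refl (a * mon ν u) (coeff p μ) (mon μ u) (ev (rem μ p)))

    coeff-rem-same : ∀ μ p → coeff (rem μ p) μ ≈ 0#
    coeff-rem-same μ [] = refl
    coeff-rem-same μ ((a , ν) ∷ p) with ≡-dec ℕ._≟_ ν μ
    ... | yes _ = coeff-rem-same μ p
    ... | no ne = trans (coeff-cons a ν (rem μ p) μ) (trans (+-cong (coeff-single-no a ν μ ne) (coeff-rem-same μ p)) (+-identityˡ _))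

    coeff-rem-other : ∀ μ p ν → ν ≢ μ → coeff (rem μ p) ν ≈ coeff p ν
    coeff-rem-other μ [] ν ne = refl
    coeff-rem-other μ ((a , ρ) ∷ p) ν ne with ≡-dec ℕ._≟_ ρ μ
    ... | yes P.refl = trans (coeff-rem-other ρ p ν ne) (sym (trans (coeff-cons a ρ p ν) (trans (+-congʳ (coeff-single-no a ρ ν (λ e → ne (P.sym e)))) (+-identityˡ _))))
    ... | no _ = trans (coeff-cons a ρ (rem μ p) ν) (trans (+-congˡ (coeff-rem-other μ p ν ne)) (sym (coeff-cons a ρ p ν)))

    len-rem : ∀ μ p → length (rem μ p) ≤ length p
    len-rem μ [] = z≤n
    len-rem μ ((a , ν) ∷ p) with ≡-dec ℕ._≟_ ν μ
    ... | yes _ = ℕP.m≤n⇒m≤1+n (len-rem μ p)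
    ... | no _ = s≤s (len-rem μ p)

    len-rem-head : ∀ a μ p → length (rem μ ((a , μ) ∷ p)) ≤ length p
    len-rem-head a μ p with ≡-dec ℕ._≟_ μ μ
    ... | yes _ = len-rem μ p
    ... | no ne = ⊥-elim (ne P.refl)

    ev-zero-bounded : ∀ n p → length p ≤ n → p ≋ [] → ev p ≈ 0#
    ev-zero-bounded n [] le e = refl
    ev-zero-bounded (suc n) ((a , μ) ∷ p) (s≤s le) (mk e) = begin
      ev ((a , μ) ∷ p) ≈⟨ ev-rem μ ((a , μ) ∷ p) ⟩
      coeff ((a , μ) ∷ p) μ * mon μ u + ev (rem μ ((a , μ) ∷ p)) ≈⟨ +-cong (trans (*-congʳ (e μ)) (zeroˡ _)) (ev-zero-bounded n (rem μ ((a , μ) ∷ p)) (ℕP.≤-trans (len-rem-head a μ p) le) (mk e')) ⟩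
      0# + 0# ≈⟨ +-identityˡ _ ⟩
      0# ∎
      where
      e' : ∀ ν → coeff (rem μ ((a , μ) ∷ p)) ν ≈ 0#
      e' ν with ≡-dec ℕ._≟_ ν μ
      ... | yes P.refl = coeff-rem-same ν ((a , ν) ∷ p)
      ... | no ne = trans (coeff-rem-other μ ((a , μ) ∷ p) ν ne) (e ν)

    ev-zero : ∀ p → p ≋ [] → ev p ≈ 0#
    ev-zero p = ev-zero-bounded (length p) p ℕP.≤-refl

    -- Negation, used to reduce  p ≋ q  to  p - q ≋ 0.
    negP : Pol → Pol
    negP = map (λ t → (- proj₁ t , proj₂ t))

    coeff-negP : ∀ q μ → coeff (negP q) μ ≈ - coeff q μ
    coeff-negP [] μ = sym -0#≈0#
    coeff-negP ((b , β) ∷ q) μ = trans (coeff-cons (- b) β (negP q) μ) (trans (+-cong (lem (≡-dec ℕ._≟_ β μ)) (coeff-negP q μ))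
      (trans (solve 2 (λ x y → (:- x) :+ (:- y) := :- (x :+ y)) refl _ _) (-‿cong (sym (coeff-cons b β q μ)))))
      where
      lem : Dec (β ≡ μ) → coeff ((- b , β) ∷ []) μ ≈ - coeff ((b , β) ∷ []) μ
      lem (yes P.refl) = trans (coeff-single-yes _ β) (-‿cong (sym (coeff-single-yes b β)))
      lem (no ne) = trans (coeff-single-no _ β μ ne) (sym (trans (-‿cong (coeff-single-no b β μ ne)) -0#≈0#))

    ev-negP : ∀ q → ev (negP q) ≈ - ev q
    ev-negP [] = sym -0#≈0#
    ev-negP ((b , β) ∷ q) = trans (+-congˡ (ev-negP q)) (solve 3 (λ b x e → (:- b) :* x :+ (:- e) := :- (b :* x :+ e)) refl b (mon β u) (ev q))

    ev-≋ : ∀ {p q} → p ≋ q → ev p ≈ ev q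
    ev-≋ {p} {q} (mk e) = begin
      ev p ≈⟨ solve 2 (λ a b → a := (a :+ (:- b)) :+ b) refl (ev p) (ev q) ⟩
      (ev p + - ev q) + ev q ≈⟨ +-congʳ (trans (+-congˡ (sym (ev-negP q))) (sym (ev-++ p (negP q)))) ⟩
      ev (p ++ negP q) + ev q ≈⟨ +-congʳ (ev-zero (p ++ negP q) (mk λ μ → trans (coeff-++ p (negP q) μ) (trans (+-cong (e μ) (coeff-negP q μ)) (-‿inverseʳ _)))) ⟩
      0# + ev q ≈⟨ +-identityˡ _ ⟩
      ev q ∎


-- Reachability inside an induced subgraph is decided by
-- iterating "reachable in ≤ t steps" until it stabilises; the reachable set
-- of a vertex yields a cut both for disconnected and articulated graphs.
module GraphCuts {n : ℕ} (G : Graph n) where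
  open import Data.Nat as ℕ using (zero; suc; _<_; z≤n; s≤s)
  import Data.Nat.Properties as ℕP
  open import Data.Fin as Fin using (Fin)
  import Data.Fin.Properties as FinP
  open import Data.Bool using (Bool; true; false; _∧_; _∨_; if_then_else_)
  open import Data.List as List using (_∷_; allFin)
  open import Data.Bool.ListAction using (any)
  import Data.List.Properties as ListP
  open import Data.List.Membership.Propositional using (_∈_)
  open import Data.List.Membership.Propositional.Properties using (∈-allFin)
  open import Data.List.Relation.Unary.Any using (here; there)
  open import Data.Product using (∃-syntax; _×_; _,_; proj₁; proj₂)
  import Data.Product.Properties as ProductP
  open import Data.Sum using (inj₁; inj₂)
  open import Data.Unit.Polymorphic using (⊤; tt)
  open import Relation.Binary.Definitions using (DecidableEquality)
  open import Relation.Nullary using (¬_; yes; no; Dec; does)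
  open import Data.Empty using (⊥; ⊥-elim)
  open import Relation.Binary.PropositionalEquality as P using (_≡_; _≢_)
  import Data.List.Membership.DecPropositional as DecMembership
  open Graph G
  open Counting

  pair≟ : DecidableEquality (Fin n × Fin n)
  pair≟ = ProductP.≡-dec (Fin._≟_ {n}) (Fin._≟_ {n})
  open DecMembership pair≟ using (_∈?_)

  adj? : ∀ a b → Dec (Adj G a b)
  adj? a b with (a , b) ∈? edges | (b , a) ∈? edges
  ... | yes p | _ = yes (inj₁ p)
  ... | no _ | yes q = yes (inj₂ q)
  ... | no p | no q = no λ { (inj₁ x) → p x ; (inj₂ y) → q y }

  module _ {Q : Fin n → Set} where
    path-head : ∀ {a b} → PathIn G Q a b → Q a
    path-head (here q) = q
    path-head (step q _ _) = q

    path-snoc : ∀ {a z x} → PathIn G Q a z → Q x → Adj G z x → PathIn G Q a x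
    path-snoc (here q) qx ad = step q ad (here qx)
    path-snoc (step q ad p) qx ad' = step q ad (path-snoc p qx ad')

  T : Bool → Set
  T b = b ≡ true

  ∨-T : ∀ {a b} → T (a ∨ b) → T a ⊎ T b
  ∨-T {true} e = inj₁ P.refl
  ∨-T {false} e = inj₂ e

  ∧-T : ∀ {a b} → T (a ∧ b) → T a × T b
  ∧-T {true} {true} e = P.refl , P.refl

  any-T : ∀ {A : Set} (f : A → Bool) xs → T (any f xs) → ∃[ x ] (x ∈ xs × T (f x))
  any-T f (x ∷ xs) e with f x in eq
  ... | true = x , here P.refl , eq
  ... | false = let (y , m , t) = any-T f xs e in y , there m , t

  any-intro : ∀ {A : Set} (f : A → Bool) xs x → x ∈ xs → T (f x) → T (any f xs)
  any-intro f (y ∷ xs) x (here P.refl) t rewrite t = P.refl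
  any-intro f (y ∷ xs) x (there m) t with f y
  ... | true = P.refl
  ... | false = any-intro f xs x m t

  impl? : ∀ a b → Dec (T a → T b)
  impl? a true = yes (λ _ → P.refl)
  impl? false false = yes (λ e → e)
  impl? true false = no (λ f → false≢true (f P.refl))
    where
    false≢true : false ≢ true
    false≢true ()

  dec-T : ∀ {A : Set} (d : Dec A) → T (does d) → A
  dec-T (yes a) _ = a

  T-dec : ∀ {A : Set} (d : Dec A) → A → T (does d)
  T-dec (yes a) _ = P.refl
  T-dec (no na) a = ⊥-elim (na a)

  -- Vertices reachable from u inside Q.  reach t holds for the vertices at
  -- distance ≤ t; it grows until it is stable, which must happen within n
  -- steps, and the stable set is exactly the set of vertices reachable from u.
  module Reach (Q : Fin n → Set) (Q? : ∀ x → Dec (Q x)) (u : Fin n) (Qu : Q u) where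
    reach : ℕ → Fin n → Bool
    reach zero x = does (x Fin.≟ u)
    reach (suc t) x = reach t x ∨ (does (Q? x) ∧ any (λ z → reach t z ∧ does (adj? z x)) (allFin n))

    sound : ∀ t x → T (reach t x) → PathIn G Q u x
    sound zero x e with x Fin.≟ u
    ... | yes P.refl = here Qu
    sound (suc t) x e with ∨-T {reach t x} e
    ... | inj₁ r = sound t x r
    ... | inj₂ r with ∧-T {does (Q? x)} r
    ... | (qx , an) with any-T _ (allFin n) an
    ... | (z , _ , rz) with ∧-T {reach t z} rz
    ... | (rz' , az) = path-snoc (sound t z rz') (dec-T (Q? x) qx) (dec-T (adj? z x) az)

    mono : ∀ t x → T (reach t x) → T (reach (suc t) x)
    mono t x e rewrite e = P.refl

    -- At a stable stage the reached set is closed under steps inside Q,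
    -- hence contains every vertex joined to u inside Q.
    Stable : ℕ → Set
    Stable t = ∀ x → T (reach (suc t) x) → T (reach t x)

    stable-step : ∀ t → Stable t → ∀ z x → T (reach t z) → Q x → Adj G z x → T (reach t x)
    stable-step t cl z x rz qx ad = cl x lem
      where
      lem : T (reach (suc t) x)
      lem with reach t x
      ... | true = P.refl
      ... | false rewrite T-dec (Q? x) qx = any-intro _ (allFin n) z (∈-allFin z) (P.subst (λ b → T (b ∧ does (adj? z x))) (P.sym rz) (T-dec (adj? z x) ad))

    complete-if-stable : ∀ t → Stable t → ∀ {a x} → PathIn G Q a x → T (reach t a) → T (reach t x)
    complete-if-stable t cl (here _) r = r
    complete-if-stable t cl (step {a} {w} qa ad p) r = complete-if-stable t cl p (stable-step t cl a w r (path-head p) ad)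

    -- The number of reached vertices grows at every unstable stage and is at
    -- most n, so stage n cannot be reached without stabilising.
    size : ℕ → ℕ
    size t = count (reach t) (allFin n)

    stable? : ∀ t → Dec (Stable t)
    stable? t = FinP.all? (λ x → impl? (reach (suc t) x) (reach t x))

    unstable-grows : ∀ t → ¬ Stable t → suc (size t) ≤ size (suc t)
    unstable-grows t ncl with FinP.¬∀⟶∃¬ n (λ x → T (reach (suc t) x) → T (reach t x)) (λ x → impl? (reach (suc t) x) (reach t x)) ncl
    ... | (y , ny) = count-strict (reach t) (reach (suc t)) (allFin n) (mono t) y (∈-allFin y) (gained (reach (suc t) y) (reach t y) ny) (lacked (reach (suc t) y) (reach t y) ny)
      where
      gained : ∀ a b → ¬ (T a → T b) → T a
      gained true b _ = P.refl
      gained false b h = ⊥-elim (h (λ ()))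
      lacked : ∀ a b → ¬ (T a → T b) → b ≡ false
      lacked a false _ = P.refl
      lacked a true h = ⊥-elim (h (λ _ → P.refl))

    size-0 : 1 ≤ size 0
    size-0 = ℕP.≤-trans (s≤s z≤n) (count-strict (λ _ → false) (reach 0) (allFin n) (λ _ ()) u (∈-allFin u) (T-dec (u Fin.≟ u) P.refl) P.refl)

    stabilises-or-grows : ∀ t → (∃[ s ] Stable s) ⊎ (suc t ≤ size t)
    stabilises-or-grows zero = inj₂ size-0
    stabilises-or-grows (suc t) with stabilises-or-grows t
    ... | inj₁ r = inj₁ r
    ... | inj₂ le with stable? t
    ... | yes cl = inj₁ (t , cl)
    ... | no ncl = inj₂ (ℕP.≤-trans (s≤s le) (unstable-grows t ncl))

    stable-stage : ∃[ s ] Stable s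
    stable-stage with stabilises-or-grows n
    ... | inj₁ r = r
    ... | inj₂ le = ⊥-elim (ℕP.<⇒≱ le (P.subst (size n ≤_) (ListP.length-tabulate (λ x → x)) (count-≤-length (reach n) (allFin n))))

    reachable : Fin n → Bool
    reachable = reach (proj₁ stable-stage)

    reachable-sound : ∀ x → T (reachable x) → PathIn G Q u x
    reachable-sound = sound (proj₁ stable-stage)

    reachable-complete : ∀ {x} → PathIn G Q u x → T (reachable x)
    reachable-complete p = complete-if-stable (proj₁ stable-stage) (proj₂ stable-stage) p (u-reached (proj₁ stable-stage))
      where
      u-reached : ∀ t → T (reach t u)
      u-reached zero = T-dec (u Fin.≟ u) P.refl
      u-reached (suc t) = mono t u (u-reached t)

  record Cut : Set where
    field
      v : Fin n
      A : Fin n → Bool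
      u w : Fin n
      Au : T (A u)
      Aw : A w ≡ false
      w≢v : w ≢ v
      leaves-A-at-v : ∀ {i j} → (i , j) ∈ edges → (T (A i) → T (A j) ⊎ j ≡ v) × (T (A j) → T (A i) ⊎ i ≡ v)
      joined-to-v : ∀ i → T (A i) → PathIn G (λ _ → ⊤) v i

  notT : ∀ b → ¬ T b → b ≡ false
  notT true h = ⊥-elim (h P.refl)
  notT false h = P.refl

  T? : ∀ b → Dec (T b)
  T? true = yes P.refl
  T? false = no (λ ())

  -- For an articulation vertex v with u, w separated in G - v, take A the
  -- vertices reachable from u avoiding v.
  cut-of-articulated : Articulated G → Cut
  cut-of-articulated (conn , v , u , w , u≢v , w≢v , np) = record
    { v = v ; A = reachable ; u = u ; w = w
    ; Au = reachable-complete (here u≢v)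
    ; Aw = notT (reachable w) (λ t → np (reachable-sound w t))
    ; w≢v = w≢v
    ; leaves-A-at-v = λ {i} {j} mem → (λ ai → side i j ai (inj₁ mem)) , (λ aj → side j i aj (inj₂ mem))
    ; joined-to-v = λ i _ → conn v i }
    where
    Q? : ∀ x → Dec (x ≢ v)
    Q? x with x Fin.≟ v
    ... | yes e = no (λ ne → ne e)
    ... | no ne = yes ne
    open Reach (λ x → x ≢ v) Q? u u≢v
    side : ∀ i j → T (reachable i) → Adj G i j → T (reachable j) ⊎ j ≡ v
    side i j ai ad with j Fin.≟ v
    ... | yes e = inj₂ e
    ... | no ne = inj₁ (reachable-complete (path-snoc (reachable-sound i ai) ne ad))

  component : Fin n → Fin n → Bool
  component a = Reach.reachable (λ _ → ⊤) (λ _ → yes tt) a tt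

  -- For a disconnected graph, take A the component of some u not containing
  -- some w, and v = u.
  cut-of-disconnected : Disconnected G → Cut
  cut-of-disconnected dis with FinP.all? (λ a → FinP.all? (λ b → T? (component a b)))
  ... | yes all-joined = ⊥-elim (dis (λ a b → Reach.reachable-sound (λ _ → ⊤) (λ _ → yes tt) a tt b (all-joined a b)))
  ... | no not-all with FinP.¬∀⟶∃¬ n _ (λ a → FinP.all? (λ b → T? (component a b))) not-all
  ... | (u , u-not-all) with FinP.¬∀⟶∃¬ n _ (λ b → T? (component u b)) u-not-all
  ... | (w , w∉A) = record
    { v = u ; A = reachable ; u = u ; w = w
    ; Au = u∈A
    ; Aw = notT (reachable w) w∉A
    ; w≢v = λ e → w∉A (P.subst (λ z → T (reachable z)) (P.sym e) u∈A)
    ; leaves-A-at-v = λ {i} {j} mem →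
        (λ ai → inj₁ (reachable-complete (path-snoc (reachable-sound i ai) tt (inj₁ mem)))) ,
        (λ aj → inj₁ (reachable-complete (path-snoc (reachable-sound j aj) tt (inj₂ mem))))
    ; joined-to-v = reachable-sound }
    where
    open Reach (λ _ → ⊤) (λ _ → yes tt) u tt
    u∈A : T (reachable u)
    u∈A = reachable-complete (here tt)

  cut : Disconnected G ⊎ Articulated G → Cut
  cut (inj₁ d) = cut-of-disconnected d
  cut (inj₂ a) = cut-of-articulated a


module CoordinateMaps {c ℓ} (K : Field c ℓ) {n : ℕ} (G : Graph n) (C : Coordinates K G) where
  open import Data.Fin as Fin using (Fin)
  open import Data.List as List using (allFin)
  open import Data.Product using (_,_; proj₁; proj₂)
  open import Data.Sum using (inj₁; inj₂)
  import Relation.Binary.Reasoning.Setoid as SetoidReasoning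

  open FieldArithmetic K
  open FiniteSums K
  open Graph G
  open Coordinates C
  open SetoidReasoning setoid

  Vx : Set c
  Vx = Fin n → Carrier

  Σm : (Fin dim → Carrier) → Carrier
  Σm f = ΣL f (allFin dim)

  πv : Fin dim → Vx → Carrier
  πv k x = ΣK K (λ i → π k i * x i)

  πv-cong : ∀ k {x y : Vx} → (∀ i → x i ≈ y i) → πv k x ≈ πv k y
  πv-cong k e = ΣL-cong (allFin n) (λ i → *-congˡ (e i))

  πv-- : ∀ k (x y : Vx) → πv k (λ i → x i - y i) ≈ πv k x - πv k y
  πv-- k x y = trans (ΣL-cong (allFin n) (λ i → solve 3 (λ p a b → p :* (a :- b) := p :* a :- p :* b) refl (π k i) (x i) (y i))) (ΣL-- _ _ (allFin n))

  πv-scale : ∀ k a (x : Vx) → πv k (λ i → a * x i) ≈ a * πv k x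
  πv-scale k a x = trans (ΣL-cong (allFin n) (λ i → solve 3 (λ p a b → p :* (a :* b) := a :* (p :* b)) refl (π k i) a (x i))) (ΣL-*ˡ a _ (allFin n))

  πv-sum : ∀ k (cc : Fin dim → Carrier) (X : Fin dim → Vx) → πv k (λ i → Σm (λ j → cc j * X j i)) ≈ Σm (λ j → cc j * πv k (X j))
  πv-sum k cc X = begin
    ΣL (λ i → π k i * ΣL (λ j → cc j * X j i) (allFin dim)) (allFin n) ≈⟨ ΣL-cong (allFin n) (λ i → sym (ΣL-*ˡ (π k i) _ (allFin dim))) ⟩
    ΣL (λ i → ΣL (λ j → π k i * (cc j * X j i)) (allFin dim)) (allFin n) ≈⟨ ΣL-swap _ (allFin n) (allFin dim) ⟩
    ΣL (λ j → ΣL (λ i → π k i * (cc j * X j i)) (allFin n)) (allFin dim) ≈⟨ ΣL-cong (allFin dim) (λ j → πv-scale k (cc j) (X j)) ⟩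
    Σm (λ j → cc j * πv k (X j)) ∎

  inW-zero : ∀ (x : Vx) → InW K G x → ∀ k → πv k x ≈ 0#
  inW-zero x w = proj₂ (kerπ x) w

  inW-intro : ∀ (x : Vx) → (∀ k → πv k x ≈ 0#) → InW K G x
  inW-intro x h = proj₁ (kerπ x) h

  pathW : ∀ (y : Vx) {Q : Fin n → Set} → InW K G y → ∀ {a b} → PathIn G Q a b → y a ≈ y b
  pathW y w (here _) = refl
  pathW y w (step _ (inj₁ mem) p) = trans (w mem) (pathW y w p)
  pathW y w (step _ (inj₂ mem) p) = trans (sym (w mem)) (pathW y w p)

  xs : Fin dim → Vx
  xs j = proj₁ (surj (δ j))

  xs-spec : ∀ j k → πv k (xs j) ≈ δ j k
  xs-spec j k = proj₂ (surj (δ j)) k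

  -- A linear map θ of Kⁿ mapping W into W descends to Kⁿ/W: in the
  -- coordinates u it acts by the matrix M k j = u_k (θ (xs j)).
  module InducedMatrix (θ : Vx → Vx)
      (θ-lin : ∀ (x y : Vx) i → θ (λ i → x i - y i) i ≈ θ x i - θ y i)
      (θ-sum : ∀ (cc : Fin dim → Carrier) (X : Fin dim → Vx) i →
               θ (λ i → Σm (λ j → cc j * X j i)) i ≈ Σm (λ j → cc j * θ (X j) i))
      (θ-W : ∀ (w : Vx) → InW K G w → ∀ k → πv k (θ w) ≈ 0#) where

    M : Fin dim → Fin dim → Carrier
    M k j = πv k (θ (xs j))

    π∘θ≈M∘π : ∀ k0 (y : Vx) → πv k0 (θ y) ≈ Σm (λ j → πv j y * M k0 j)
    π∘θ≈M∘π k0 y = begin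
      πv k0 (θ y)                                ≈⟨ diff0 y-Z-killed ⟩
      πv k0 (θ Z)                                ≈⟨ πv-cong k0 (θ-sum cj xs) ⟩
      πv k0 (λ i → Σm (λ j → cj j * θ (xs j) i)) ≈⟨ πv-sum k0 cj (λ j → θ (xs j)) ⟩
      Σm (λ j → πv j y * M k0 j)                 ∎
      where
      cj = λ j → πv j y
      -- Z is the lift of the coordinates of y along the section, so y - Z ∈ W.
      Z : Vx
      Z i = Σm (λ j → cj j * xs j i)
      Z-coords : ∀ k → πv k Z ≈ πv k y
      Z-coords k = trans (πv-sum k cj xs) (trans (ΣL-cong (allFin dim) (λ j → *-congˡ (xs-spec j k))) (Σ-δˡ cj k))
      y-Z∈W : InW K G (λ i → y i - Z i)
      y-Z∈W = inW-intro _ (λ k → trans (πv-- k y Z) (trans (+-congˡ (-‿cong (Z-coords k))) (-‿inverseʳ _)))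
      y-Z-killed : πv k0 (θ y) - πv k0 (θ Z) ≈ 0#
      y-Z-killed = begin
        πv k0 (θ y) - πv k0 (θ Z)          ≈⟨ sym (πv-- k0 (θ y) (θ Z)) ⟩
        πv k0 (λ i → θ y i - θ Z i)        ≈⟨ πv-cong k0 (λ i → sym (θ-lin y Z i)) ⟩
        πv k0 (θ (λ i → y i - Z i))        ≈⟨ θ-W _ y-Z∈W k0 ⟩
        0#                                 ∎

module EdgeRescaling {c ℓ} (K : Field c ℓ) (cz : CharZero K) {n : ℕ} (G : Graph n)
                     (C : Coordinates K G) (cut : GraphCuts.Cut G) (mindeg : MinDegreeAtLeast1 G) where
  open import Data.Nat as ℕ using (suc)
  open import Data.Fin as Fin using (Fin)
  open import Data.Bool using (Bool; true; false; _∨_; if_then_else_; not)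
  open import Data.Bool.Properties using (∨-zeroʳ)
  open import Data.List as List using (allFin; length)
  open import Data.List.Membership.Propositional using (_∈_)
  open import Data.Product using (∃-syntax; _×_; _,_; proj₁; proj₂)
  open import Data.Sum using (inj₁; inj₂; [_,_]′)
  import Data.Integer as ℤ
  open import Relation.Nullary using (¬_)
  open import Data.Empty using (⊥; ⊥-elim)
  open import Relation.Binary.PropositionalEquality as P using (_≡_; _≢_)
  import Relation.Binary.Reasoning.Setoid as SetoidReasoning

  open FieldArithmetic K
  open FiniteSums K
  open Graph G
  open Coordinates C
  open Counting
  open GraphCuts G using (T; notT)
  open GraphCuts.Cut cut
  open CoordinateMaps K G C
  open SetoidReasoning setoid

  private
    false≢true : false ≢ true
    false≢true ()

  θ1 : Vx → Vx
  θ1 y i = if A i then y i - y v else 0#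

  inA : Fin n × Fin n → Bool
  inA (i , j) = A i ∨ A j

  Nn N1 : Carrier
  Nn = nc (length edges)
  N1 = nc (count inA edges)

  θ : Vx → Vx
  θ y i = Nn * θ1 y i - N1 * y i

  ce : Fin n × Fin n → Carrier
  ce e = Nn * indicator (inA e) - N1

  -- Because edges leaving A end at v, θ₁ multiplies each edge form by [edge meets A].
  edge-θ1 : ∀ (y : Vx) {i j} → (i , j) ∈ edges → θ1 y i - θ1 y j ≈ indicator (inA (i , j)) * (y i - y j)
  edge-θ1 y {i} {j} mem with A i | A j | leaves-A-at-v mem
  ... | true | true | _ = trans (solve 3 (λ a b c → (a :- c) :- (b :- c) := (a :- b)) refl (y i) (y j) (y v)) (sym (*-identityˡ _))
  ... | true | false | (f , _) with f P.refl
  ...   | inj₁ aj = ⊥-elim (false≢true aj)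
  ...   | inj₂ P.refl = trans (solve 2 (λ a c → (a :- c) :- con (ℤ.+ 0) := (a :- c)) refl (y i) (y v)) (sym (*-identityˡ _))
  edge-θ1 y {i} {j} mem | false | true | (_ , g) with g P.refl
  ...   | inj₁ ai = ⊥-elim (false≢true ai)
  ...   | inj₂ P.refl = trans (solve 2 (λ b c → con (ℤ.+ 0) :- (b :- c) := (c :- b)) refl (y j) (y v)) (sym (*-identityˡ _))
  edge-θ1 y {i} {j} mem | false | false | _ = solve 2 (λ a b → con (ℤ.+ 0) :- con (ℤ.+ 0) := con (ℤ.+ 0) :* (a :- b)) refl (y i) (y j)

  edge-θ : ∀ (y : Vx) {i j} → (i , j) ∈ edges → θ y i - θ y j ≈ ce (i , j) * (y i - y j)
  edge-θ y {i} {j} mem = begin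
    (Nn * θ1 y i - N1 * y i) - (Nn * θ1 y j - N1 * y j) ≈⟨ solve 6 (λ N M a b c d → (N :* a :- M :* c) :- (N :* b :- M :* d) := N :* (a :- b) :- M :* (c :- d)) refl Nn N1 (θ1 y i) (θ1 y j) (y i) (y j) ⟩
    Nn * (θ1 y i - θ1 y j) - N1 * (y i - y j) ≈⟨ +-congʳ (*-congˡ (edge-θ1 y mem)) ⟩
    Nn * (indicator (inA (i , j)) * (y i - y j)) - N1 * (y i - y j) ≈⟨ solve 4 (λ N M t d → N :* (t :* d) :- M :* d := (N :* t :- M) :* d) refl Nn N1 (indicator (inA (i , j))) (y i - y j) ⟩
    ce (i , j) * (y i - y j) ∎

  -- θ₁ kills W, since on A a vector of W equals its value at v.
  θ1-W : ∀ (w : Vx) → InW K G w → ∀ i → θ1 w i ≈ 0#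
  θ1-W w iw i with A i in ai
  ... | true = trans (+-congʳ (sym (pathW w iw (joined-to-v i ai)))) (-‿inverseʳ _)
  ... | false = refl

  θ-W : ∀ (w : Vx) → InW K G w → ∀ i → θ w i ≈ - (N1 * w i)
  θ-W w iw i = trans (+-congʳ (trans (*-congˡ (θ1-W w iw i)) (zeroʳ _))) (+-identityˡ _)

  θ1-v : ∀ (y : Vx) → θ1 y v ≈ 0#
  θ1-v y with A v
  ... | true = -‿inverseʳ _
  ... | false = refl

  θ1-idem : ∀ (y : Vx) i → θ1 (θ1 y) i ≈ θ1 y i
  θ1-idem y i with A i
  ... | true = trans (+-congˡ (trans (-‿cong (θ1-v y)) -0#≈0#)) (+-identityʳ _)
  ... | false = refl

  θ1-lin : ∀ (x y : Vx) i → θ1 (λ i → x i - y i) i ≈ θ1 x i - θ1 y i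
  θ1-lin x y i with A i
  ... | true = solve 4 (λ a b c d → (a :- b) :- (c :- d) := (a :- c) :- (b :- d)) refl (x i) (y i) (x v) (y v)
  ... | false = solve 0 (con (ℤ.+ 0) := con (ℤ.+ 0) :- con (ℤ.+ 0)) refl

  θ-lin : ∀ (x y : Vx) i → θ (λ i → x i - y i) i ≈ θ x i - θ y i
  θ-lin x y i = trans (+-congʳ (*-congˡ (θ1-lin x y i)))
    (solve 6 (λ N M a b c d → N :* (a :- b) :- M :* (c :- d) := (N :* a :- M :* c) :- (N :* b :- M :* d)) refl Nn N1 (θ1 x i) (θ1 y i) (x i) (y i))

  θ1-sum : ∀ (cc : Fin dim → Carrier) (X : Fin dim → Vx) i → θ1 (λ i → Σm (λ j → cc j * X j i)) i ≈ Σm (λ j → cc j * θ1 (X j) i)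
  θ1-sum cc X i with A i
  ... | true = trans (sym (ΣL-- _ _ (allFin dim))) (ΣL-cong (allFin dim) (λ j → sym (solve 3 (λ c a b → c :* (a :- b) := c :* a :- c :* b) refl (cc j) (X j i) (X j v))))
  ... | false = sym (ΣL-0 (allFin dim) (λ j → zeroʳ _))

  θ-sum : ∀ (cc : Fin dim → Carrier) (X : Fin dim → Vx) i → θ (λ i → Σm (λ j → cc j * X j i)) i ≈ Σm (λ j → cc j * θ (X j) i)
  θ-sum cc X i = begin
    Nn * θ1 Z i - N1 * Z i ≈⟨ +-cong (*-congˡ (θ1-sum cc X i)) (-‿cong (*-congˡ refl)) ⟩
    Nn * Σm (λ j → cc j * θ1 (X j) i) - N1 * Σm (λ j → cc j * X j i) ≈⟨ +-cong (sym (ΣL-*ˡ Nn _ (allFin dim))) (-‿cong (sym (ΣL-*ˡ N1 _ (allFin dim)))) ⟩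
    Σm (λ j → Nn * (cc j * θ1 (X j) i)) - Σm (λ j → N1 * (cc j * X j i)) ≈⟨ sym (ΣL-- _ _ (allFin dim)) ⟩
    Σm (λ j → Nn * (cc j * θ1 (X j) i) - N1 * (cc j * X j i)) ≈⟨ ΣL-cong (allFin dim) (λ j → solve 5 (λ N M c a b → N :* (c :* a) :- M :* (c :* b) := c :* (N :* a :- M :* b)) refl Nn N1 (cc j) (θ1 (X j) i) (X j i)) ⟩
    Σm (λ j → cc j * θ (X j) i) ∎
    where Z = λ i → Σm (λ j → cc j * X j i)



  θ-W-coords : ∀ (w : Vx) → InW K G w → ∀ k → πv k (θ w) ≈ 0#
  θ-W-coords w w∈W k = begin
    πv k (θ w)               ≈⟨ πv-cong k (λ i → trans (θ-W w w∈W i) (-‿distribˡ-* _ _)) ⟩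
    πv k (λ i → (- N1) * w i) ≈⟨ πv-scale k (- N1) w ⟩
    (- N1) * πv k w          ≈⟨ *-congˡ (inW-zero w w∈W k) ⟩
    (- N1) * 0#              ≈⟨ zeroʳ _ ⟩
    0#                       ∎

  open InducedMatrix θ θ-lin θ-sum θ-W-coords public

  πv-θ : ∀ k (y : Vx) → πv k (θ y) ≈ Nn * πv k (θ1 y) - N1 * πv k y
  πv-θ k y = trans (πv-- k _ _) (+-cong (πv-scale k Nn (θ1 y)) (-‿cong (πv-scale k N1 y)))

  -- No row of M vanishes when N₁ ≠ 0 and N - N₁ ≠ 0: if row k₀ did, u_k₀ ∘ θ = 0;
  -- with y₁ = xs k₀ and a = u_k₀(θ₁ y₁), applying this to y₁ and to θ₁ y₁
  -- (θ₁ is idempotent) gives N a - N₁ = 0 and (N - N₁) a = 0, whence N₁ = 0.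
  no-zero-row : ¬ (N1 ≈ 0#) → ¬ (Nn - N1 ≈ 0#) → ∀ k0 → (∀ j → M k0 j ≈ 0#) → ⊥
  no-zero-row n1 n2 k0 hM = n1 N1≈0
    where
    all0 : ∀ y → πv k0 (θ y) ≈ 0#
    all0 y = trans (π∘θ≈M∘π k0 y) (ΣL-0 (allFin dim) (λ j → trans (*-congˡ (hM j)) (zeroʳ _)))
    y1 = xs k0
    a = πv k0 (θ1 y1)
    E1 : Nn * a - N1 ≈ 0#
    E1 = trans (+-congˡ (-‿cong (sym (trans (*-congˡ (trans (xs-spec k0 k0) (δ-same k0))) (*-identityʳ _))))) (trans (sym (πv-θ k0 y1)) (all0 y1))
    E2 : (Nn - N1) * a ≈ 0#
    E2 = begin
      (Nn - N1) * a ≈⟨ solve 3 (λ N M a → (N :- M) :* a := N :* a :- M :* a) refl Nn N1 a ⟩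
      Nn * a - N1 * a ≈⟨ +-congʳ (*-congˡ (sym (πv-cong k0 (θ1-idem y1)))) ⟩
      Nn * πv k0 (θ1 (θ1 y1)) - N1 * πv k0 (θ1 y1) ≈⟨ sym (πv-θ k0 (θ1 y1)) ⟩
      πv k0 (θ (θ1 y1)) ≈⟨ all0 (θ1 y1) ⟩
      0# ∎
    a0 : a ≈ 0#
    a0 = cancelNZ n2 E2
    N1≈0 : N1 ≈ 0#
    N1≈0 = begin
      N1 ≈⟨ solve 3 (λ N M a → M := N :* a :- (N :* a :- M)) refl Nn N1 a ⟩
      Nn * a - (Nn * a - N1) ≈⟨ +-cong (trans (*-congˡ a0) (zeroʳ _)) (-‿cong E1) ⟩
      0# - 0# ≈⟨ solve 0 (con (ℤ.+ 0) :- con (ℤ.+ 0) := con (ℤ.+ 0)) refl ⟩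
      0# ∎

  M-rescales-edge : ∀ {i j} → (i , j) ∈ edges → ∀ j' → Σm (λ k → form i j k * M k j') ≈ ce (i , j) * form i j j'
  M-rescales-edge {i} {j} mem j' = begin
    Σm (λ k → form i j k * πv k (θ y)) ≈⟨ form-spec mem (θ y) ⟩
    θ y i - θ y j ≈⟨ edge-θ y mem ⟩
    ce (i , j) * (y i - y j) ≈⟨ *-congˡ (sym (form-spec mem y)) ⟩
    ce (i , j) * Σm (λ k → form i j k * πv k y) ≈⟨ *-congˡ (ΣL-cong (allFin dim) (λ k → *-congˡ (xs-spec j' k))) ⟩
    ce (i , j) * Σm (λ k → form i j k * δ j' k) ≈⟨ *-congˡ (Σ-δʳ (form i j) j') ⟩
    ce (i , j) * form i j j' ∎
    where y = xs j'


  -- The rescaling factors sum to N·N₁ - N₁·N = 0.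
  Σ-ce≈0 : ΣL ce edges ≈ 0#
  Σ-ce≈0 = begin
    ΣL (λ e → Nn * indicator (inA e) - N1) edges ≈⟨ ΣL-- _ _ edges ⟩
    ΣL (λ e → Nn * indicator (inA e)) edges - ΣL (λ _ → N1) edges ≈⟨ +-cong (ΣL-*ˡ Nn _ edges) (-‿cong (trans (ΣL-cong edges (λ _ → sym (*-identityʳ N1))) (ΣL-*ˡ N1 _ edges))) ⟩
    Nn * ΣL (λ e → indicator (inA e)) edges - N1 * ΣL (λ _ → 1#) edges ≈⟨ +-cong (*-congˡ (ΣL-indicator inA edges)) (-‿cong (*-congˡ (ΣL-1 edges))) ⟩
    Nn * N1 - N1 * Nn ≈⟨ solve 2 (λ a b → a :* b :- b :* a := con (ℤ.+ 0)) refl Nn N1 ⟩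
    0# ∎


  edges-meeting-A≉0 : ∀ e → e ∈ edges → inA e ≡ true → ¬ (N1 ≈ 0#)
  edges-meeting-A≉0 e mem ie with count-pos inA edges e mem ie
  ... | (k , eq) = λ z → cz k (trans (reflexive (P.cong nc (P.sym eq))) z)

  edges-missing-A≉0 : ∀ e → e ∈ edges → inA e ≡ false → ¬ (Nn - N1 ≈ 0#)
  edges-missing-A≉0 e mem ie with count-pos (λ x → not (inA x)) edges e mem (P.cong not ie)
  ... | (k , eq) = λ z → cz k (begin
      nc (suc k) ≈⟨ reflexive (P.cong nc (P.sym eq)) ⟩
      N2 ≈⟨ solve 2 (λ a b → b := (a :+ b) :- a) refl N1 N2 ⟩
      (N1 + N2) - N1 ≈⟨ +-congʳ (sym (trans (reflexive (P.cong nc (count-split inA edges))) (nc-+ (count inA edges) (count (λ x → not (inA x)) edges)))) ⟩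
      Nn - N1 ≈⟨ z ⟩
      0# ∎)
    where N2 = nc (count (λ x → not (inA x)) edges)


  -- Minimum degree ≥ 1 gives an edge meeting A (at u) and one missing A (at w).
  edge-meeting-A : ∃[ e ] (e ∈ edges × inA e ≡ true)
  edge-meeting-A with mindeg u
  ... | (z , inj₁ mem) = (u , z) , mem , P.cong (_∨ A z) Au
  ... | (z , inj₂ mem) = (z , u) , mem , P.trans (P.cong (A z ∨_) Au) (∨-zeroʳ (A z))

  -- A neighbour of w is outside A, since w ∉ A, w ≠ v and edges leaving A end at v.
  neighbour-of-w : ∀ {z} → (T (A z) → T (A w) ⊎ w ≡ v) → A z ≡ false
  neighbour-of-w {z} h = notT (A z) λ az → [ (λ aw → false≢true (P.trans (P.sym Aw) aw)) , w≢v ]′ (h az)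

  edge-missing-A : ∃[ e ] (e ∈ edges × inA e ≡ false)
  edge-missing-A with mindeg w
  ... | (z , inj₁ mem) = (w , z) , mem , P.cong₂ _∨_ Aw (neighbour-of-w (proj₂ (leaves-A-at-v mem)))
  ... | (z , inj₂ mem) = (z , w) , mem , P.cong₂ _∨_ (neighbour-of-w (proj₁ (leaves-A-at-v mem))) Aw

  N1≉0 : ¬ (N1 ≈ 0#)
  N1≉0 = let (e , mem , ie) = edge-meeting-A in edges-meeting-A≉0 e mem ie

  N-N1≉0 : ¬ (Nn - N1 ≈ 0#)
  N-N1≉0 = let (e , mem , ie) = edge-missing-A in edges-missing-A≉0 e mem ie

module DegreeOneSyzygy {c ℓ} (K : Field c ℓ) (cz : CharZero K) {n : ℕ} (G : Graph n)
                       (C : Coordinates K G) (cut : GraphCuts.Cut G) (mindeg : MinDegreeAtLeast1 G) where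
  open import Data.Nat as ℕ using (zero; suc)
  import Data.Nat.Properties as ℕP
  open import Data.Fin as Fin using (Fin)
  open import Data.List as List using ([]; map; allFin)
  open import Data.List.Membership.Propositional using (_∈_)
  open import Data.Product using (_×_; _,_; proj₁; proj₂)
  open import Relation.Nullary using (¬_)
  open import Data.Empty using (⊥-elim)
  open import Relation.Binary.PropositionalEquality as P using (_≡_; _≢_)
  import Relation.Binary.Reasoning.Setoid as SetoidReasoning
  open ExponentVectors

  open FieldArithmetic K
  open FiniteSums K
  open Graph G
  open Coordinates C
  open CoordinateMaps K G C
  open EdgeRescaling K cz G C cut mindeg
  open PolynomialRing K dim
  open LinearFormsAndDerivations K dim
  open Poly K dim
  open SetoidReasoning setoid

  Pk : Fin dim → Pol
  Pk k = linear (M k)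

  D-edge : ∀ {i j} → (i , j) ∈ edges → D Pk (linear (form i j)) ≋ (const (ce (i , j)) *P linear (form i j))
  D-edge {i} {j} mem = PR.begin
    D Pk (linear b)                                        PR.≈⟨ D-linear Pk b ⟩
    SP (λ k → const (b k) *P linear (M k)) (allFin dim)    PR.≈⟨ SP-cong (allFin dim) (λ k → scale-linear (b k) (M k)) ⟩
    SP (λ k → linear (λ j' → b k * M k j')) (allFin dim)   PR.≈⟨ SP-linear (λ k j' → b k * M k j') (allFin dim) ⟩
    linear (λ j' → Σm (λ k → b k * M k j'))                PR.≈⟨ linear-cong (M-rescales-edge mem) ⟩
    linear (λ j' → ce (i , j) * b j')                      PR.≈⟨ ≋-sym (scale-linear (ce (i , j)) b) ⟩
    const (ce (i , j)) *P linear b                         PR.∎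
    where b = form i j

  -- Hence D_P F = (Σ ce) F = 0.  (F is taken as the product of any family g
  -- of edge forms, so that it unifies with the defining polynomial.)
  syzygy : ∀ (g : Fin n × Fin n → Pol) → (∀ i j → g (i , j) ≡ linear (form i j)) →
           D Pk (prodP (map g edges)) ≋ []
  syzygy g g≡α = ≋-trans (D-prod Pk g ce edges edge-case) (const-zero _ _ Σ-ce≈0)
    where
    edge-case : ∀ e → e ∈ edges → D Pk (g e) ≋ (const (ce e) *P g e)
    edge-case (i , j) mem rewrite g≡α i j = D-edge mem

  Pk-homogeneous : ∀ k → Homogeneous 1 (Pk k)
  Pk-homogeneous k μ = linear-homog (M k) μ

  -- Some coordinate index exists, because the edge form of an edge is not 0.
  some-index : Fin dim
  some-index = index-of-nonzero-sum dim _ edge-form≉0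
    where
    i = proj₁ (proj₁ edge-meeting-A)
    j = proj₂ (proj₁ edge-meeting-A)
    mem : (i , j) ∈ edges
    mem = proj₁ (proj₂ edge-meeting-A)
    i≢j : i ≢ j
    i≢j eq = ℕP.<-irrefl (P.cong Fin.toℕ eq) (ordered mem)
    index-of-nonzero-sum : ∀ m (f : Fin m → Carrier) → ¬ (ΣL f (allFin m) ≈ 0#) → Fin m
    index-of-nonzero-sum zero f h = ⊥-elim (h refl)
    index-of-nonzero-sum (suc m) f h = Fin.zero
    edge-form≉0 : ¬ (Σm (λ k → form i j k * πv k (δ i)) ≈ 0#)
    edge-form≉0 z = 1≉0 (begin
      1#                                  ≈⟨ sym (trans (+-cong (δ-same i) (-‿cong (δ-diff i j i≢j))) (trans (+-congˡ -0#≈0#) (+-identityʳ _))) ⟩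
      δ i i - δ i j                       ≈⟨ sym (form-spec mem (δ i)) ⟩
      Σm (λ k → form i j k * πv k (δ i))  ≈⟨ z ⟩
      0#                                  ∎)

  Pk-nonzero : ¬ (Pk some-index ≈P 0P)
  Pk-nonzero z = no-zero-row N1≉0 N-N1≉0 some-index (λ j → trans (sym (coeff-linear-unit (M some-index) j)) (z (unit j)))

  hasSyzygyOfDegree1 : HasSyzygyOfDegree K G C 1
  hasSyzygyOfDegree1 = Pk , Pk-homogeneous , (some-index , Pk-nonzero) , get (syzygy _ (λ i j → P.refl))

module NoConstantSyzygy {c ℓ} (K : Field c ℓ) (cz : CharZero K) {n : ℕ} (G : Graph n)
                        (C : Coordinates K G) where
  open import Data.Nat as ℕ using (_<_)
  import Data.Nat.Properties as ℕP
  open import Data.Fin as Fin using (Fin)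
  import Data.Fin.Properties as FinP
  open import Data.Vec.Properties using (≡-dec)
  open import Data.List as List using ([]; _∷_; map; allFin)
  open import Data.List.Membership.Propositional using (_∈_)
  open import Data.List.Relation.Unary.Any using (here; there)
  open import Data.List.Relation.Unary.Unique.Propositional using (Unique)
  open import Data.List.Relation.Unary.AllPairs using (_∷_)
  open import Data.Product using (_×_; _,_; proj₁; proj₂)
  open import Relation.Nullary using (¬_; yes; no; Dec)
  open import Data.Empty using (⊥; ⊥-elim)
  open import Relation.Binary.PropositionalEquality as P using (_≡_; _≢_)
  import Relation.Binary.Reasoning.Setoid as SetoidReasoning
  open ExponentVectors

  open FieldArithmetic K
  open FiniteSums K
  open Graph G
  open Coordinates C
  open CoordinateMaps K G C
  open PolynomialRing K dim
  open LinearFormsAndDerivations K dim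
  open Evaluation K dim
  open Poly K dim
  open SetoidReasoning setoid

  homogeneous-0-constant : ∀ Q → Homogeneous 0 Q → Q ≋ const (coeff Q z0)
  homogeneous-0-constant Q hom = mk λ μ → at μ (≡-dec ℕ._≟_ z0 μ)
    where
    at : ∀ μ → Dec (z0 ≡ μ) → coeff Q μ ≈ coeff (const (coeff Q z0)) μ
    at .z0 (yes P.refl) = sym (coeff-single-yes _ z0)
    at μ (no z0≢μ) = trans (hom μ (λ d → z0≢μ (P.sym (sum≡0⇒zeros μ d)))) (sym (coeff-single-no _ z0 μ z0≢μ))

  module ProductAtPoint {X : Set} (Q : Fin dim → Pol) (g : X → Pol) (u0 : Fin dim → Carrier) where
    E : Pol → Carrier
    E = ev u0

    ev-leib : ∀ L Π → E (D Q (L *P Π)) ≈ E (D Q L) * E Π + E L * E (D Q Π)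
    ev-leib L Π = trans (ev-≋ u0 (D-leib Q L Π))
      (trans (ev-++ u0 (D Q L *P Π) (L *P D Q Π)) (+-cong (ev-*P u0 (D Q L) Π) (ev-*P u0 L (D Q Π))))

    product-nonzero : ∀ es → (∀ f → f ∈ es → ¬ (E (g f) ≈ 0#)) → ¬ (E (prodP (map g es)) ≈ 0#)
    product-nonzero [] h e = 1≉0 (trans (sym (ev-const u0 1#)) e)
    product-nonzero (f ∷ es) h e =
      nz-mul (h f (here P.refl)) (product-nonzero es (λ f' m → h f' (there m))) (trans (sym (ev-*P u0 (g f) _)) e)

    product-zero : ∀ es e0 → e0 ∈ es → E (g e0) ≈ 0# → E (prodP (map g es)) ≈ 0#
    product-zero (f ∷ es) e0 (here P.refl) z = trans (ev-*P u0 (g f) _) (trans (*-congʳ z) (zeroˡ _))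
    product-zero (f ∷ es) e0 (there m) z = trans (ev-*P u0 (g f) _) (trans (*-congˡ (product-zero es e0 m z)) (zeroʳ _))

    leib-left : ∀ f Π → E (g f) ≈ 0# → E (D Q (g f *P Π)) ≈ E (D Q (g f)) * E Π
    leib-left f Π z = trans (ev-leib (g f) Π) (trans (+-congˡ (trans (*-congʳ z) (zeroˡ _))) (+-identityʳ _))

    leib-right : ∀ f Π → E Π ≈ 0# → E (D Q (g f *P Π)) ≈ E (g f) * E (D Q Π)
    leib-right f Π z = trans (ev-leib (g f) Π) (trans (+-congʳ (trans (*-congˡ z) (zeroʳ _))) (+-identityˡ _))

    derivative-nonzero : ∀ es e0 → Unique es → e0 ∈ es →
        (∀ f → f ∈ es → f ≢ e0 → ¬ (E (g f) ≈ 0#)) → E (g e0) ≈ 0# →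
        ¬ (E (D Q (g e0)) ≈ 0#) → ¬ (E (D Q (prodP (map g es))) ≈ 0#)
    derivative-nonzero (f ∷ es) e0 (f∉es ∷ u) (here P.refl) h z dz e =
      nz-mul dz (product-nonzero es (λ f' m → h f' (there m) (∉-tail f∉es m)))
        (trans (sym (leib-left f _ z)) e)
    derivative-nonzero (f ∷ es) e0 (f∉es ∷ u) (there m) h z dz e =
      nz-mul (h f (here P.refl) (λ eq → ∉-tail f∉es m (P.sym eq)))
        (derivative-nonzero es e0 u m (λ f' m' → h f' (there m')) z dz)
        (trans (sym (leib-right f _ (product-zero es e0 m z))) e)

  -- For an edge {i,j} (i < j) the point x_p = toℕ(σ p), where σ sends j to i,
  -- lies on the hyperplane of {i,j} and on no other edge hyperplane.
  module SeparatingPoint (g : Fin n × Fin n → Pol) (g≡α : ∀ i j → g (i , j) ≡ linear (form i j))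
                         (i j : Fin n) (i<j : i Fin.< j) where
    σ : Fin n → Fin n
    σ x with x Fin.≟ j
    ... | yes _ = i
    ... | no _ = x

    xe : Vx
    xe x = nc (Fin.toℕ (σ x))

    u0 : Fin dim → Carrier
    u0 k = πv k xe

    σ-j : σ j ≡ i
    σ-j with j Fin.≟ j
    ... | yes _ = P.refl
    ... | no ne = ⊥-elim (ne P.refl)

    σ-other : ∀ x → x ≢ j → σ x ≡ x
    σ-other x ne with x Fin.≟ j
    ... | yes e = ⊥-elim (ne e)
    ... | no _ = P.refl

    i≢j : i ≢ j
    i≢j eq = ℕP.<-irrefl (P.cong Fin.toℕ eq) i<j

    ev-g : ∀ {p q} → (p , q) ∈ edges → ev u0 (g (p , q)) ≈ xe p - xe q
    ev-g {p} {q} mem = trans (reflexive (P.cong (ev u0) (g≡α p q))) (trans (ev-linear u0 (form p q)) (form-spec mem xe))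

    ev-g-zero : (i , j) ∈ edges → ev u0 (g (i , j)) ≈ 0#
    ev-g-zero mem = trans (ev-g mem)
      (trans (+-congʳ (reflexive (P.cong (λ z → nc (Fin.toℕ z)) (P.trans (σ-other i i≢j) (P.sym σ-j))))) (-‿inverseʳ _))

    σ-eq : ∀ p q → Fin.toℕ p < Fin.toℕ q → σ p ≡ σ q → (p , q) ≡ (i , j)
    σ-eq p q p<q e with p Fin.≟ j | q Fin.≟ j
    ... | yes P.refl | yes P.refl = ⊥-elim (ℕP.<-irrefl P.refl p<q)
    ... | yes P.refl | no _ = ⊥-elim (ℕP.<-irrefl (P.cong Fin.toℕ e) (ℕP.<-trans i<j p<q))
    ... | no _ | yes P.refl = P.cong (_, q) e
    ... | no _ | no _ = ⊥-elim (ℕP.<-irrefl (P.cong Fin.toℕ e) p<q)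

    ev-g-nonzero : ∀ f → f ∈ edges → f ≢ (i , j) → ¬ (ev u0 (g f) ≈ 0#)
    ev-g-nonzero (p , q) mem ne z =
      ne (σ-eq p q (ordered mem) (FinP.toℕ-injective (nc-injective cz _ _ (diff0 (trans (sym (ev-g mem)) z)))))

  -- For constant coefficients a, with π b = a, D_a maps the edge form of
  -- {p,q} to b_p - b_q; a syzygy D_a F = 0 then forces b ∈ W (up to ¬¬).
  module ConstantDerivation (a : Fin dim → Carrier)
                            (g : Fin n × Fin n → Pol) (g≡α : ∀ i j → g (i , j) ≡ linear (form i j)) where
    Qc : Fin dim → Pol
    Qc k = const (a k)

    b : Vx
    b = proj₁ (surj a)

    b-spec : ∀ k → πv k b ≈ a k
    b-spec = proj₂ (surj a)

    ev-D-edge : ∀ u0 {p q} → (p , q) ∈ edges → ev u0 (D Qc (g (p , q))) ≈ b p - b q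
    ev-D-edge u0 {p} {q} mem = begin
      ev u0 (D Qc (g (p , q)))                       ≡⟨ P.cong (λ z → ev u0 (D Qc z)) (g≡α p q) ⟩
      ev u0 (D Qc (linear (form p q)))               ≈⟨ ev-≋ u0 (D-linear Qc (form p q)) ⟩
      ev u0 (SP (λ k → const (form p q k) *P Qc k) (allFin dim)) ≈⟨ ev-SP u0 _ (allFin dim) ⟩
      Σm (λ k → ev u0 (const (form p q k) *P Qc k))  ≈⟨ ΣL-cong (allFin dim) (λ k → ev-const-product k) ⟩
      Σm (λ k → form p q k * πv k b)                 ≈⟨ form-spec mem b ⟩
      b p - b q                                      ∎
      where
      ev-const-product : ∀ k → ev u0 (const (form p q k) *P Qc k) ≈ form p q k * πv k b
      ev-const-product k = trans (ev-*P u0 (const (form p q k)) (Qc k))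
        (*-cong (ev-const u0 (form p q k)) (trans (ev-const u0 (a k)) (sym (b-spec k))))

    edge-constant : D Qc (prodP (map g edges)) ≋ [] → ∀ {i j} → (i , j) ∈ edges → ¬ ¬ (b i ≈ b j)
    edge-constant syz {i} {j} mem bi≉bj =
      derivative-nonzero edges (i , j) unique mem ev-g-nonzero (ev-g-zero mem) D-edge≉0 (ev-zero u0 _ syz)
      where
      open SeparatingPoint g g≡α i j (ordered mem)
      open ProductAtPoint Qc g u0
      D-edge≉0 : ¬ (ev u0 (D Qc (g (i , j))) ≈ 0#)
      D-edge≉0 z = bi≉bj (diff0 (trans (sym (ev-D-edge u0 mem)) z))

  ¬¬-all-edges : ∀ {P : Fin n → Fin n → Set ℓ} es → (∀ {i j} → (i , j) ∈ es → ¬ ¬ P i j) →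
                 ¬ ¬ (∀ {i j} → (i , j) ∈ es → P i j)
  ¬¬-all-edges [] h k = k (λ ())
  ¬¬-all-edges ((i , j) ∷ es) h k =
    h (here P.refl) (λ pij → ¬¬-all-edges es (λ m → h (there m)) (λ rest → k (λ { (here P.refl) → pij ; (there m) → rest m })))

  noSyzygyOfDegree0 : ¬ HasSyzygyOfDegree K G C 0
  noSyzygyOfDegree0 (Q , hom , (k1 , Qk1≉0) , syz) = impossible _ (λ i j → P.refl) (mk syz)
    where
    a : Fin dim → Carrier
    a k = coeff (Q k) z0

    a-k1≉0 : ¬ (a k1 ≈ 0#)
    a-k1≉0 e = Qk1≉0 (get (≋-trans (homogeneous-0-constant (Q k1) (hom k1)) (const-0 e)))

    impossible : (g : Fin n × Fin n → Pol) → (∀ i j → g (i , j) ≡ linear (form i j)) →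
                 D Q (prodP (map g edges)) ≋ [] → ⊥
    impossible g g≡α syzQ = ¬¬-all-edges edges (edge-constant syzc) (λ b∈W → a-k1≉0 (trans (sym (b-spec k1)) (inW-zero b b∈W k1)))
      where
      open ConstantDerivation a g g≡α
      syzc : D Qc (prodP (map g edges)) ≋ []
      syzc = ≋-trans (SP-cong (allFin dim) (λ k → *P-congˡ (∂ k _) (≋-sym (homogeneous-0-constant (Q k) (hom k))))) syzQ

-- r(G) = 1: a cut gives a syzygy of degree 1, and none of degree 0 exists.
lemma4p1 : ∀ {c ℓ : Level} (K : Field c ℓ) → CharZero K →
           ∀ (n : ℕ) (G : Graph n) →
           2 ≤ length (Graph.edges G) →
           MinDegreeAtLeast1 G →
           (Disconnected G ⊎ Articulated G) →
           ∀ (C : Coordinates K G) → rIs K G C 1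
lemma4p1 K cz n G _ mindeg disconnected-or-articulated C =
  DegreeOneSyzygy.hasSyzygyOfDegree1 K cz G C cut mindeg , none-below-1
  where
  cut : GraphCuts.Cut G
  cut = GraphCuts.cut G disconnected-or-articulated

  none-below-1 : ∀ s → s < 1 → ¬ HasSyzygyOfDegree K G C s
  none-below-1 .0 (s≤s z≤n) = NoConstantSyzygy.noSyzygyOfDegree0 K cz G C
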